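{- There is no integer $N$ such that for every finite field $\mathbb{F}$ there is a sentence $\psi_{\mathbb{F}}$ of $\mathit{MS}_0$ containing at most $N$ variables with the property that a (finite) matroid is $\mathbb{F}$-representable if and only if it satisfies $\psi_{\mathbb{F}}$.
   Context: All matroids are finite. $\mathit{MS}_0$ is the following monadic second-order language for matroids. It has variables $X_1,X_2,\ldots$, atomic formulas $X_i\subseteq X_j$, $\mathrm{Sing}(X_i)$, $\mathrm{Ind}(X_i)$, connectives $\neg,\land$ and quantifiers $\exists,\forall$. Formulas $\psi$, with variable sets $\mathrm{Var}(\psi)$ and free-variable sets $\mathrm{Fr}(\psi)$, are built recursively: an atomic formula has $\mathrm{Fr}=\mathrm{Var}=$ the variables occurring in it; $\neg\psi$ has the same $\mathrm{Var},\mathrm{Fr}$ as $\psi$; $\psi_1\land\psi_2$ is a formula provided $\mathrm{Fr}(\psi_i)\cap(\mathrm{Var}(\psi_j)-\mathrm{Fr}(\psi_j))=\emptyset$ for $\{i,j\}=\{1,2\}$, with $\mathrm{Var},\mathrm{Fr}$ the unions; if $X_i\in\mathrm{Fr}(\psi)$ then $\exists X_i\,\psi$ and $\forall X_i\,\psi$ are formulas with variable set $\mathrm{Var}(\psi)$ and free-variable set $\mathrm{Fr}(\psi)-\{X_i\}$. A sentence is a formula with no free variables; its number of variables is $|\mathrm{Var}(\psi)|$. A matroid $M$ satisfies a sentence if it is true with variables ranging over subsets of $E(M)$, $\subseteq$ as containment, $\mathrm{Sing}(X)$ meaning $|X|=1$, $\mathrm{Ind}(X)$ meaning $X$ independent in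 $M$. -}

module Defs where

open import Level using (0ℓ)
open import Data.Nat using (ℕ; zero; suc; _≤_; _≟_)
open import Data.Bool using (Bool; T)
open import Data.Fin using (Fin; zero; suc)
open import Data.Fin.Subset using (Subset; ⊥; _⊆_; _∈_; _∉_; ∣_∣; _∪_)
open import Data.List using (List; []; _∷_; _++_; filter; length; deduplicate)
open import Data.List.Membership.Propositional using () renaming (_∈_ to _∈ˡ_)
open import Data.Product using (Σ; ∃; _×_; _,_)
open import Relation.Nullary using (¬_; ¬?)
open import Relation.Binary.PropositionalEquality using (_≡_)
open import Algebra.Bundles using (CommutativeRing)

record Matroid (n : ℕ) : Set where
  field
    indep     : Subset n → Bool
    I1        : T (indep ⊥)
    I2        : ∀ {X Y} → X ⊆ Y → T (indep Y) → T (indep X)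
    I3        : ∀ {X Y} → T (indep X) → T (indep Y) → ∣ X ∣ Data.Nat.< ∣ Y ∣ →
                Σ (Fin n) λ e → e ∈ Y × e ∉ X × T (indep (Data.Fin.Subset.⁅ e ⁆ ∪ X))
open Matroid public

record Field : Set₁ where
  field
    commRing : CommutativeRing 0ℓ 0ℓ
  open CommutativeRing commRing public using (Carrier; _≈_; _+_; _*_; 0#; 1#)
  field
    0≉1      : ¬ (0# ≈ 1#)
    inverse  : ∀ x → ¬ (x ≈ 0#) → Σ Carrier λ y → (x * y) ≈ 1#

IsFinite : Field → Set
IsFinite F = Σ ℕ λ q → Σ (Fin q → Carrier) λ enum → ∀ x → Σ (Fin q) λ i → enum i ≈ x
  where open Field F

module _ (F : Field) where
  open Field F

  Σ[_] : ∀ {n} → (Fin n → Carrier) → Carrier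
  Σ[_] {ℕ.zero}  f = 0#
  Σ[_] {ℕ.suc n} f = f zero + Σ[ (λ j → f (suc j)) ]

  ColumnsIndependent : ∀ {r n} → (Fin r → Fin n → Carrier) → Subset n → Set
  ColumnsIndependent {r} {n} A X =
    (c : Fin n → Carrier) →
    (∀ j → j ∉ X → c j ≈ 0#) →
    (∀ i → Σ[ (λ j → c j * A i j) ] ≈ 0#) →
    ∀ j → j ∈ X → c j ≈ 0#

  Representable : ∀ {n} → Matroid n → Set
  Representable {n} M =
    Σ ℕ λ r → Σ (Fin r → Fin n → Carrier) λ A →
      ∀ X → (T (indep M X) → ColumnsIndependent A X)
          × (ColumnsIndependent A X → T (indep M X))

-- The monadic second-order language MS₀ (variable X_i is represented by i).

data Formula : Set where
  _⊆′_  : ℕ → ℕ → Formula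
  Sing  : ℕ → Formula
  Ind   : ℕ → Formula
  ¬′_   : Formula → Formula
  _∧′_  : Formula → Formula → Formula
  ∃′    : ℕ → Formula → Formula
  ∀′    : ℕ → Formula → Formula

Var : Formula → List ℕ
Var (i ⊆′ j)  = i ∷ j ∷ []
Var (Sing i)  = i ∷ []
Var (Ind i)   = i ∷ []
Var (¬′ ψ)    = Var ψ
Var (ψ ∧′ φ)  = Var ψ ++ Var φ
Var (∃′ i ψ)  = Var ψ
Var (∀′ i ψ)  = Var ψ

Fr : Formula → List ℕ
Fr (i ⊆′ j)  = i ∷ j ∷ []
Fr (Sing i)  = i ∷ []
Fr (Ind i)   = i ∷ []
Fr (¬′ ψ)    = Fr ψ
Fr (ψ ∧′ φ)  = Fr ψ ++ Fr φ
Fr (∃′ i ψ)  = filter (λ k → ¬? (k ≟ i)) (Fr ψ)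
Fr (∀′ i ψ)  = filter (λ k → ¬? (k ≟ i)) (Fr ψ)

Compatible : Formula → Formula → Set
Compatible ψ φ = ∀ k → k ∈ˡ Fr ψ → k ∈ˡ Var φ → k ∈ˡ Fr φ

data WellFormed : Formula → Set where
  wf⊆   : ∀ i j → WellFormed (i ⊆′ j)
  wfSing : ∀ i → WellFormed (Sing i)
  wfInd : ∀ i → WellFormed (Ind i)
  wf¬   : ∀ {ψ} → WellFormed ψ → WellFormed (¬′ ψ)
  wf∧   : ∀ {ψ φ} → WellFormed ψ → WellFormed φ →
          Compatible ψ φ → Compatible φ ψ → WellFormed (ψ ∧′ φ)
  wf∃   : ∀ {i ψ} → WellFormed ψ → i ∈ˡ Fr ψ → WellFormed (∃′ i ψ)
  wf∀   : ∀ {i ψ} → WellFormed ψ → i ∈ˡ Fr ψ → WellFormed (∀′ i ψ)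

IsSentence : Formula → Set
IsSentence ψ = WellFormed ψ × Fr ψ ≡ []

numVars : Formula → ℕ
numVars ψ = length (deduplicate _≟_ (Var ψ))

module _ {n : ℕ} (M : Matroid n) where

  update : (ℕ → Subset n) → ℕ → Subset n → (ℕ → Subset n)
  update ρ i X k with k ≟ i
  ... | Relation.Nullary.yes _ = X
  ... | Relation.Nullary.no _  = ρ k

  Sat : (ℕ → Subset n) → Formula → Set
  Sat ρ (i ⊆′ j) = ρ i ⊆ ρ j
  Sat ρ (Sing i) = ∣ ρ i ∣ ≡ 1
  Sat ρ (Ind i)  = T (indep M (ρ i))
  Sat ρ (¬′ ψ)   = ¬ Sat ρ ψ
  Sat ρ (ψ ∧′ φ) = Sat ρ ψ × Sat ρ φ
  Sat ρ (∃′ i ψ) = Σ (Subset n) λ X → Sat (update ρ i X) ψ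
  Sat ρ (∀′ i ψ) = (X : Subset n) → Sat (update ρ i X) ψ

  -- M satisfies the sentence ψ (the assignment is irrelevant for sentences)
  Satisfies : Formula → Set
  Satisfies ψ = Sat (λ _ → ⊥) ψ

-- A sentence with N variables has quantifier depth at most N: the variables bound along a chain of
-- nested quantifiers are distinct. In a uniform matroid independence depends only on size, so the truth
-- of a formula depends only on the sizes of the cells of the Venn diagram of the assigned sets, and
-- only up to a threshold that halves with each quantifier: a witness on one side is answered on the
-- other by splitting every cell alike, as far as the threshold can tell. Hence U(2,q) and U(2,q+3)
-- satisfy the same N-variable sentences once q is large. Over a field with q elements, U(2,q) is
-- represented by the points (1,t); in a representation of U(2,q+3) two of the q+1 columns beyond the
-- first two have the same slope with respect to them, so they are parallel. Prime fields are
-- arbitrarily large.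

module Submission where

open import Defs
open import Data.Nat using (ℕ; _≤_)
open import Data.Product using (Σ; _×_)
open import Relation.Nullary using (¬_)
open import Function.Bundles using (_⇔_)

module Cells where
  open import Data.Bool using (Bool; true; false; not; _∧_)
  open import Data.Bool.Properties using (∧-comm; ∧-zeroʳ)
  open import Data.Fin.Subset using (Subset; ⊤; ∣_∣; _⊆_)
  open import Data.Fin.Subset.Properties using (drop-∷-⊆)
  open import Data.Nat using (ℕ; zero; suc; _+_; _∸_; _≤_; z≤n; s≤s)
  open import Data.Nat.Properties using (+-suc; m≤m+n; m≤n+m)
  open import Data.Product using (∃; _×_; _,_)
  open import Data.Vec using ([]; _∷_; head; tail; here; there)
  open import Relation.Binary.PropositionalEquality using (_≡_; refl; sym; trans; cong; cong₂; subst)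

  private variable
    n : ℕ

  side : Bool → Bool → Bool
  side true  a = a
  side false a = not a

  infixl 7 _∩[_]_

  -- S ∩[ true ] A is S ∩ A and S ∩[ false ] A is S − A; recursion on S alone lets the
  -- second argument be an arbitrary vector (see select below).
  _∩[_]_ : Subset n → Bool → Subset n → Subset n
  []      ∩[ b ] A = []
  (s ∷ S) ∩[ b ] A = (s ∧ side b (head A)) ∷ (S ∩[ b ] tail A)

  ∩[]-swap : ∀ b c (S A B : Subset n) → S ∩[ b ] A ∩[ c ] B ≡ S ∩[ c ] B ∩[ b ] A
  ∩[]-swap b c []      A B = refl
  ∩[]-swap b c (s ∷ S) A B = cong₂ _∷_ (swap s) (∩[]-swap b c S (tail A) (tail B))
    where
    swap : ∀ s → (s ∧ side b (head A)) ∧ side c (head B) ≡ (s ∧ side c (head B)) ∧ side b (head A)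
    swap false = refl
    swap true  = ∧-comm (side b (head A)) (side c (head B))

  ∩[]-idem : ∀ b (S A : Subset n) → S ∩[ b ] A ∩[ b ] A ≡ S ∩[ b ] A
  ∩[]-idem b []      A = refl
  ∩[]-idem b (s ∷ S) A = cong₂ _∷_ (idem s (side b (head A))) (∩[]-idem b S (tail A))
    where
    idem : ∀ s x → (s ∧ x) ∧ x ≡ s ∧ x
    idem false x     = refl
    idem true  false = refl
    idem true  true  = refl

  ∣∩[]-∩[not]∣≡0 : ∀ b (S A : Subset n) → ∣ S ∩[ b ] A ∩[ not b ] A ∣ ≡ 0
  ∣∩[]-∩[not]∣≡0 b []      A = refl
  ∣∩[]-∩[not]∣≡0 b (s ∷ S) A =
    trans (cong (λ x → ∣ x ∷ S ∩[ b ] tail A ∩[ not b ] tail A ∣) (opposite s b (head A)))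
          (∣∩[]-∩[not]∣≡0 b S (tail A))
    where
    opposite : ∀ s b a → (s ∧ side b a) ∧ side (not b) a ≡ false
    opposite false b     a     = refl
    opposite true  true  false = refl
    opposite true  true  true  = refl
    opposite true  false false = refl
    opposite true  false true  = refl

  ∣p∣≡∣p∩[true]q∣+∣p∩[false]q∣ : ∀ (S A : Subset n) → ∣ S ∣ ≡ ∣ S ∩[ true ] A ∣ + ∣ S ∩[ false ] A ∣
  ∣p∣≡∣p∩[true]q∣+∣p∩[false]q∣ []          A = refl
  ∣p∣≡∣p∩[true]q∣+∣p∩[false]q∣ (false ∷ S) A = ∣p∣≡∣p∩[true]q∣+∣p∩[false]q∣ S (tail A)
  ∣p∣≡∣p∩[true]q∣+∣p∩[false]q∣ (true ∷ S) A with head A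
  ... | true  = cong suc (∣p∣≡∣p∩[true]q∣+∣p∩[false]q∣ S (tail A))
  ... | false = trans (cong suc (∣p∣≡∣p∩[true]q∣+∣p∩[false]q∣ S (tail A))) (sym (+-suc _ _))

  ∣p∩[b]q∣≤∣p∣ : ∀ b (S A : Subset n) → ∣ S ∩[ b ] A ∣ ≤ ∣ S ∣
  ∣p∩[b]q∣≤∣p∣ true  S A =
    subst (∣ S ∩[ true ] A ∣ ≤_) (sym (∣p∣≡∣p∩[true]q∣+∣p∩[false]q∣ S A)) (m≤m+n _ _)
  ∣p∩[b]q∣≤∣p∣ false S A =
    subst (∣ S ∩[ false ] A ∣ ≤_) (sym (∣p∣≡∣p∩[true]q∣+∣p∩[false]q∣ S A)) (m≤n+m _ _)

  ⊤∩[true]p≡p : ∀ (A : Subset n) → ⊤ ∩[ true ] A ≡ A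
  ⊤∩[true]p≡p []      = refl
  ⊤∩[true]p≡p (a ∷ A) = cong (a ∷_) (⊤∩[true]p≡p A)

  p⊆q⇒∣p∩[false]q∣≡0 : ∀ {S A : Subset n} → S ⊆ A → ∣ S ∩[ false ] A ∣ ≡ 0
  p⊆q⇒∣p∩[false]q∣≡0 {S = []}                   S⊆A = refl
  p⊆q⇒∣p∩[false]q∣≡0 {S = false ∷ S} {a ∷ A}    S⊆A = p⊆q⇒∣p∩[false]q∣≡0 (drop-∷-⊆ S⊆A)
  p⊆q⇒∣p∩[false]q∣≡0 {S = true ∷ S}  {true ∷ A} S⊆A = p⊆q⇒∣p∩[false]q∣≡0 (drop-∷-⊆ S⊆A)
  p⊆q⇒∣p∩[false]q∣≡0 {S = true ∷ S}  {false ∷ A} S⊆A with S⊆A here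
  ... | ()

  ∣p∩[false]q∣≡0⇒p⊆q : ∀ {S A : Subset n} → ∣ S ∩[ false ] A ∣ ≡ 0 → S ⊆ A
  ∣p∩[false]q∣≡0⇒p⊆q {S = true ∷ S}  {true ∷ A} e here      = here
  ∣p∩[false]q∣≡0⇒p⊆q {S = true ∷ S}  {true ∷ A} e (there x) = there (∣p∩[false]q∣≡0⇒p⊆q e x)
  ∣p∩[false]q∣≡0⇒p⊆q {S = false ∷ S} {a ∷ A}    e (there x) = there (∣p∩[false]q∣≡0⇒p⊆q e x)

  select : Subset n → (Bool → Subset n) → Subset n
  select []      f = []
  select (a ∷ A) f = head (f a) ∷ select A (λ b → tail (f b))

  ∩[]-select : ∀ b c (S A : Subset n) f → S ∩[ b ] select A f ∩[ c ] A ≡ S ∩[ c ] A ∩[ b ] f c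
  ∩[]-select b c []      A       f = refl
  ∩[]-select b c (s ∷ S) (a ∷ A) f = cong₂ _∷_ (pick s c a) (∩[]-select b c S A (λ b → tail (f b)))
    where
    pick : ∀ s c a → (s ∧ side b (head (f a))) ∧ side c a ≡ (s ∧ side c a) ∧ side b (head (f c))
    pick false c     a     = refl
    pick true  true  true  = ∧-comm _ true
    pick true  false false = ∧-comm _ true
    pick true  true  false = ∧-zeroʳ _
    pick true  false true  = ∧-zeroʳ _

  ∃-part-of-size : ∀ (S : Subset n) k → k ≤ ∣ S ∣ →
                   ∃ λ Y → ∣ S ∩[ true ] Y ∣ ≡ k × ∣ S ∩[ false ] Y ∣ ≡ ∣ S ∣ ∸ k
  ∃-part-of-size []          zero    _         = [] , refl , refl
  ∃-part-of-size (false ∷ S) k       k≤        with ∃-part-of-size S k k≤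
  ... | Y , p , q = false ∷ Y , p , q
  ∃-part-of-size (true ∷ S)  zero    _         with ∃-part-of-size S zero z≤n
  ... | Y , p , q = false ∷ Y , p , cong suc q
  ∃-part-of-size (true ∷ S)  (suc k) (s≤s k≤) with ∃-part-of-size S k k≤
  ... | Y , p , q = true ∷ Y , cong suc p , q

module Similarity where
  open Cells
  open import Data.Bool using (true; false)
  open import Data.Fin.Subset using (Subset; ∣_∣)
  open import Data.List using (List; []; _∷_)
  open import Data.List.Membership.Propositional using () renaming (_∈_ to _∈ˡ_)
  open import Data.List.Relation.Binary.Sublist.Propositional as Sublist using ([]; _∷_; _∷ʳ_)
  open import Data.List.Relation.Unary.Any using (here; there)
  open import Data.Nat using (ℕ; _+_; _∸_; _<_; _≤_; _<?_)
  open import Data.Nat.Properties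
  open import Data.Product using (∃; _×_; _,_; proj₁; proj₂)
  open import Relation.Binary.PropositionalEquality
  open import Relation.Nullary using (yes; no)
  open import Relation.Nullary.Negation using (contradiction)

  private variable
    m n : ℕ

  infix 4 _≃[_]_

  data _≃[_]_ : ℕ → ℕ → ℕ → Set where
    exact : ∀ {a T} → a ≃[ T ] a
    large : ∀ {a b T} → T ≤ a → T ≤ b → a ≃[ T ] b

  ≃-sym : ∀ {a b T} → a ≃[ T ] b → b ≃[ T ] a
  ≃-sym exact         = exact
  ≃-sym (large Ta Tb) = large Tb Ta

  ≃-+ : ∀ {a b c d T} → a ≃[ T ] b → c ≃[ T ] d → a + c ≃[ T ] b + d
  ≃-+                 exact         exact         = exact
  ≃-+ {a} {c = c} {d} exact         (large Tc Td) = large (≤-trans Tc (m≤n+m c a)) (≤-trans Td (m≤n+m d a))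
  ≃-+ {a} {b}         (large Ta Tb) _             = large (≤-trans Ta (m≤m+n a _)) (≤-trans Tb (m≤m+n b _))

  ≃-below : ∀ {a b k T} → k < T → a ≡ k → a ≃[ T ] b → b ≡ k
  ≃-below k<T a≡k exact        = a≡k
  ≃-below k<T refl (large Ta _) = contradiction Ta (<⇒≱ k<T)

  ≃-split : ∀ {a b s T} → a + b ≃[ T + T ] s →
            ∃ λ a' → a' ≤ s × a ≃[ T ] a' × b ≃[ T ] s ∸ a'
  ≃-split {a} {b} {T = T} exact = a , m≤m+n a b , exact , subst (b ≃[ T ]_) (sym (m+n∸m≡n a b)) exact
  ≃-split {a} {b} {s} {T} (large TT≤a+b TT≤s) with a <? T | b <? T
  ... | yes a<T | yes b<T = contradiction TT≤a+b (<⇒≱ (+-mono-< a<T b<T))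
  ... | yes a<T | no b≮T  =
    a , ≤-trans (<⇒≤ a<T) T≤s , exact , large (≮⇒≥ b≮T) (m+n≤o⇒m≤o∸n T (≤-trans (+-monoʳ-≤ T (<⇒≤ a<T)) TT≤s))
    where T≤s = ≤-trans (m≤m+n T T) TT≤s
  ... | no a≮T  | yes b<T =
    s ∸ b , m∸n≤m s b , large (≮⇒≥ a≮T) (m+n≤o⇒m≤o∸n T (≤-trans (+-monoʳ-≤ T (<⇒≤ b<T)) TT≤s)) ,
    subst (b ≃[ T ]_) (sym (m∸[m∸n]≡n (≤-trans (<⇒≤ b<T) (≤-trans (m≤m+n T T) TT≤s)))) exact
  ... | no a≮T  | no b≮T  =
    T , ≤-trans (m≤m+n T T) TT≤s , large (≮⇒≥ a≮T) ≤-refl , large (≮⇒≥ b≮T) (m+n≤o⇒m≤o∸n T TT≤s)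

  -- S and S' meet every cell of the Venn diagram of the variables in V (under ρ and ρ')
  -- in sets of sizes agreeing up to T.
  Similar : ℕ → (ℕ → Subset m) → (ℕ → Subset n) → List ℕ → Subset m → Subset n → Set
  Similar T ρ ρ' []      S S' = ∣ S ∣ ≃[ T ] ∣ S' ∣
  Similar T ρ ρ' (v ∷ V) S S' = ∀ b → Similar T ρ ρ' V (S ∩[ b ] ρ v) (S' ∩[ b ] ρ' v)

  Similar-sym : ∀ {T} {ρ : ℕ → Subset m} {ρ' : ℕ → Subset n} V {S S'} →
                Similar T ρ ρ' V S S' → Similar T ρ' ρ V S' S
  Similar-sym []      sim   = ≃-sym sim
  Similar-sym (v ∷ V) sim b = Similar-sym V (sim b)

  Similar-cong : ∀ {T} {ρ₁ ρ₂ : ℕ → Subset m} {ρ₁' ρ₂' : ℕ → Subset n} V {S S'} →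
                 (∀ {v} → v ∈ˡ V → ρ₁ v ≡ ρ₂ v) → (∀ {v} → v ∈ˡ V → ρ₁' v ≡ ρ₂' v) →
                 Similar T ρ₁ ρ₁' V S S' → Similar T ρ₂ ρ₂' V S S'
  Similar-cong []                          eq eq' sim   = sim
  Similar-cong {T = T} {ρ₂ = ρ₂} {ρ₂' = ρ₂'} (v ∷ V) {S} {S'} eq eq' sim b =
    subst₂ (Similar T ρ₂ ρ₂' V) (cong (S ∩[ b ]_) (eq (here refl))) (cong (S' ∩[ b ]_) (eq' (here refl)))
           (Similar-cong V (λ v∈V → eq (there v∈V)) (λ v∈V → eq' (there v∈V)) (sim b))

  module _ {T : ℕ} {ρ : ℕ → Subset m} {ρ' : ℕ → Subset n} where

    Similar-merge : ∀ V {S S'} (A : Subset m) (A' : Subset n) →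
                    (∀ b → Similar T ρ ρ' V (S ∩[ b ] A) (S' ∩[ b ] A')) → Similar T ρ ρ' V S S'
    Similar-merge []      {S} {S'} A A' sim =
      subst₂ (_≃[ T ]_) (sym (∣p∣≡∣p∩[true]q∣+∣p∩[false]q∣ S A)) (sym (∣p∣≡∣p∩[true]q∣+∣p∩[false]q∣ S' A'))
             (≃-+ (sim true) (sim false))
    Similar-merge (v ∷ V) {S} {S'} A A' sim c = Similar-merge V A A' λ b →
      subst₂ (Similar T ρ ρ' V) (∩[]-swap b c S A (ρ v)) (∩[]-swap b c S' A' (ρ' v)) (sim b c)

    Similar-empty : ∀ V {S S'} → ∣ S ∣ ≡ 0 → ∣ S' ∣ ≡ 0 → Similar T ρ ρ' V S S'
    Similar-empty []      S≡0 S'≡0   = subst₂ (_≃[ T ]_) (sym S≡0) (sym S'≡0) exact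
    Similar-empty (v ∷ V) {S} {S'} S≡0 S'≡0 b =
      Similar-empty V (n≤0⇒n≡0 (subst (∣ S ∩[ b ] ρ v ∣ ≤_) S≡0 (∣p∩[b]q∣≤∣p∣ b S (ρ v))))
                      (n≤0⇒n≡0 (subst (∣ S' ∩[ b ] ρ' v ∣ ≤_) S'≡0 (∣p∩[b]q∣≤∣p∣ b S' (ρ' v))))

    Similar-refine : ∀ {V i S S'} → i ∈ˡ V → Similar T ρ ρ' V S S' →
                     ∀ b → Similar T ρ ρ' V (S ∩[ b ] ρ i) (S' ∩[ b ] ρ' i)
    Similar-refine {i ∷ V} {i} {S} {S'} (here refl) sim b c with b | c
    ... | true  | true  =
      subst₂ (Similar T ρ ρ' V) (sym (∩[]-idem true S (ρ i))) (sym (∩[]-idem true S' (ρ' i))) (sim true)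
    ... | false | false =
      subst₂ (Similar T ρ ρ' V) (sym (∩[]-idem false S (ρ i))) (sym (∩[]-idem false S' (ρ' i))) (sim false)
    ... | true  | false = Similar-empty V (∣∩[]-∩[not]∣≡0 true S (ρ i)) (∣∩[]-∩[not]∣≡0 true S' (ρ' i))
    ... | false | true  = Similar-empty V (∣∩[]-∩[not]∣≡0 false S (ρ i)) (∣∩[]-∩[not]∣≡0 false S' (ρ' i))
    Similar-refine {w ∷ V} {i} {S} {S'} (there i∈V) sim b c =
      subst₂ (Similar T ρ ρ' V) (∩[]-swap c b S (ρ w) (ρ i)) (∩[]-swap c b S' (ρ' w) (ρ' i))
             (Similar-refine i∈V (sim c) b)

    Similar-sublist : ∀ {W V S S'} → W Sublist.⊆ V → Similar T ρ ρ' V S S' → Similar T ρ ρ' W S S'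
    Similar-sublist []              sim = sim
    Similar-sublist (v ∷ʳ W⊆V)      sim = Similar-merge _ (ρ v) (ρ' v) λ b → Similar-sublist W⊆V (sim b)
    Similar-sublist (refl ∷ W⊆V)    sim b = Similar-sublist W⊆V (sim b)

    Similar-split : ∀ V {S S'} → Similar (T + T) ρ ρ' V S S' → ∀ X →
                    ∃ λ X' → ∀ b → Similar T ρ ρ' V (S ∩[ b ] X) (S' ∩[ b ] X')
    Similar-split []      {S} {S'} sim X
      with ≃-split (subst (_≃[ T + T ] ∣ S' ∣) (∣p∣≡∣p∩[true]q∣+∣p∩[false]q∣ S X) sim)
    ... | a' , a'≤S' , inside≃ , outside≃ with ∃-part-of-size S' a' a'≤S'
    ... | X' , ∣inside∣ , ∣outside∣ = X' , λ
      { true  → subst (∣ S ∩[ true ] X ∣ ≃[ T ]_) (sym ∣inside∣) inside≃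
      ; false → subst (∣ S ∩[ false ] X ∣ ≃[ T ]_) (sym ∣outside∣) outside≃ }
    Similar-split (w ∷ V) {S} {S'} sim X = select (ρ' w) (λ c → proj₁ (part c)) , λ b c →
      subst₂ (Similar T ρ ρ' V) (∩[]-swap c b S (ρ w) X) (sym (∩[]-select b c S' (ρ' w) _))
             (proj₂ (part c) b)
      where
      part : ∀ c → ∃ λ X' → ∀ b → Similar T ρ ρ' V (S ∩[ c ] ρ w ∩[ b ] X) (S' ∩[ c ] ρ' w ∩[ b ] X')
      part c = Similar-split V (sim c) X

module QuantifierDepth where
  open import Data.List using (List; []; _∷_; _++_; length; filter)
  open import Data.List.Properties using (length-++-sucʳ)
  open import Data.List.Membership.Propositional using () renaming (_∈_ to _∈ˡ_)
  open import Data.List.Membership.Propositional.Properties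
    using (∈-filter⁺; ∈-filter⁻; ∈-++⁺ˡ; ∈-++⁺ʳ; ∈-++⁻; ∈-∃++; ∈-deduplicate⁺)
  open import Data.List.Relation.Binary.Subset.Propositional using () renaming (_⊆_ to _⊆ˡ_)
  open import Data.List.Relation.Binary.Disjoint.Propositional using (Disjoint)
  open import Data.List.Relation.Unary.All as All using (All)
  open import Data.List.Relation.Unary.Any using (here; there)
  open import Data.List.Relation.Unary.Unique.Propositional using (Unique; []; _∷_)
  open import Data.Nat using (ℕ; suc; _⊔_; _≤_; z≤n; s≤s; _≟_)
  open import Data.Nat.Properties using (≤-total; m≤n⇒m⊔n≡n; m≥n⇒m⊔n≡m; ≤-trans; ≤-reflexive)
  open import Data.Product using (_×_; _,_; proj₁)
  open import Data.Empty using (⊥)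
  open import Data.Sum using (_⊎_; inj₁; inj₂)
  open import Relation.Binary.PropositionalEquality
  open import Relation.Nullary using (¬?)
  open import Relation.Nullary.Negation using (contradiction)

  depth : Formula → ℕ
  depth (i ⊆′ j) = 0
  depth (Sing i) = 0
  depth (Ind i)  = 0
  depth (¬′ ψ)   = depth ψ
  depth (ψ ∧′ φ) = depth ψ ⊔ depth φ
  depth (∃′ i ψ) = suc (depth ψ)
  depth (∀′ i ψ) = suc (depth ψ)

  length-mono-⊆ : ∀ {xs ys : List ℕ} → Unique xs → xs ⊆ˡ ys → length xs ≤ length ys
  length-mono-⊆ []                  _     = z≤n
  length-mono-⊆ {x ∷ xs} (x≢xs ∷ xs!) xs⊆ys with ∈-∃++ (xs⊆ys (here refl))
  ... | us , vs , refl =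
    ≤-trans (s≤s (length-mono-⊆ xs! xs⊆us++vs)) (≤-reflexive (sym (length-++-sucʳ us x vs)))
    where
    xs⊆us++vs : xs ⊆ˡ us ++ vs
    xs⊆us++vs {z} z∈xs with ∈-++⁻ us (xs⊆ys (there z∈xs))
    ... | inj₁ z∈us         = ∈-++⁺ˡ z∈us
    ... | inj₂ (here z≡x)   = contradiction (sym z≡x) (All.lookup x≢xs z∈xs)
    ... | inj₂ (there z∈vs) = ∈-++⁺ʳ us z∈vs

  Fr⊆Var : ∀ ψ → Fr ψ ⊆ˡ Var ψ
  Fr⊆Var (i ⊆′ j) k∈ = k∈
  Fr⊆Var (Sing i) k∈ = k∈
  Fr⊆Var (Ind i)  k∈ = k∈
  Fr⊆Var (¬′ ψ)   k∈ = Fr⊆Var ψ k∈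
  Fr⊆Var (ψ ∧′ φ) k∈ with ∈-++⁻ (Fr ψ) k∈
  ... | inj₁ k∈ψ = ∈-++⁺ˡ (Fr⊆Var ψ k∈ψ)
  ... | inj₂ k∈φ = ∈-++⁺ʳ (Var ψ) (Fr⊆Var φ k∈φ)
  Fr⊆Var (∃′ i ψ) k∈ = Fr⊆Var ψ (proj₁ (∈-filter⁻ (λ k → ¬? (k ≟ i)) {xs = Fr ψ} k∈))
  Fr⊆Var (∀′ i ψ) k∈ = Fr⊆Var ψ (proj₁ (∈-filter⁻ (λ k → ¬? (k ≟ i)) {xs = Fr ψ} k∈))

  -- The variables bound along a deepest chain of nested quantifiers: pairwise distinct,
  -- because a variable bound inside a well-formed formula is never free in it.
  record QuantifierChain (vars frees : List ℕ) (d : ℕ) : Set where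
    field
      bound        : List ℕ
      unique       : Unique bound
      bound⊆vars   : bound ⊆ˡ vars
      bound∩frees  : Disjoint bound frees
      length≡depth : length bound ≡ d

  QuantifierChain-[] : ∀ {vs fs} → QuantifierChain vs fs 0
  QuantifierChain-[] = record
    { bound = [] ; unique = [] ; bound⊆vars = λ () ; bound∩frees = λ () ; length≡depth = refl }

  module _ {vs fs : List ℕ} {d : ℕ} (chain : QuantifierChain vs fs d) where
    open QuantifierChain chain

    QuantifierChain-++ˡ : ∀ {vs' fs'} → (∀ k → k ∈ˡ fs' → k ∈ˡ vs → k ∈ˡ fs) →
                          QuantifierChain (vs' ++ vs) (fs' ++ fs) d
    QuantifierChain-++ˡ {vs'} {fs'} compatible = record
      { bound = bound ; unique = unique ; bound⊆vars = λ k∈ → ∈-++⁺ʳ vs' (bound⊆vars k∈)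
      ; bound∩frees = λ { (k∈ , k∈fs'++fs) → disjoint k∈ (∈-++⁻ fs' k∈fs'++fs) }
      ; length≡depth = length≡depth }
      where
      disjoint : ∀ {k} → k ∈ˡ bound → k ∈ˡ fs' ⊎ k ∈ˡ fs → ⊥
      disjoint k∈ (inj₁ k∈fs') = bound∩frees (k∈ , compatible _ k∈fs' (bound⊆vars k∈))
      disjoint k∈ (inj₂ k∈fs)  = bound∩frees (k∈ , k∈fs)

    QuantifierChain-++ʳ : ∀ {vs' fs'} → (∀ k → k ∈ˡ fs' → k ∈ˡ vs → k ∈ˡ fs) →
                          QuantifierChain (vs ++ vs') (fs ++ fs') d
    QuantifierChain-++ʳ {vs'} {fs'} compatible = record
      { bound = bound ; unique = unique ; bound⊆vars = λ k∈ → ∈-++⁺ˡ (bound⊆vars k∈)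
      ; bound∩frees = λ { (k∈ , k∈fs++fs') → disjoint k∈ (∈-++⁻ fs k∈fs++fs') }
      ; length≡depth = length≡depth }
      where
      disjoint : ∀ {k} → k ∈ˡ bound → k ∈ˡ fs ⊎ k ∈ˡ fs' → ⊥
      disjoint k∈ (inj₁ k∈fs)  = bound∩frees (k∈ , k∈fs)
      disjoint k∈ (inj₂ k∈fs') = bound∩frees (k∈ , compatible _ k∈fs' (bound⊆vars k∈))

    QuantifierChain-bind : ∀ {i} → i ∈ˡ fs → i ∈ˡ vs →
                           QuantifierChain vs (filter (λ k → ¬? (k ≟ i)) fs) (suc d)
    QuantifierChain-bind {i} i∈fs i∈vs = record
      { bound = i ∷ bound
      ; unique = All.tabulate (λ k∈ i≡k → bound∩frees (k∈ , subst (_∈ˡ fs) i≡k i∈fs)) ∷ unique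
      ; bound⊆vars = λ { (here refl) → i∈vs ; (there k∈) → bound⊆vars k∈ }
      ; bound∩frees = λ { (k∈ , k∈Fr) → disjoint k∈ (∈-filter⁻ (λ k → ¬? (k ≟ i)) {xs = fs} k∈Fr) }
      ; length≡depth = cong suc length≡depth }
      where
      disjoint : ∀ {k} → k ∈ˡ i ∷ bound → k ∈ˡ fs × k ≢ i → ⊥
      disjoint (here k≡i)  (_ , k≢i)  = k≢i k≡i
      disjoint (there k∈) (k∈fs , _) = bound∩frees (k∈ , k∈fs)

  quantifierChain : ∀ {ψ} → WellFormed ψ → QuantifierChain (Var ψ) (Fr ψ) (depth ψ)
  quantifierChain (wf⊆ i j)  = QuantifierChain-[]
  quantifierChain (wfSing i) = QuantifierChain-[]
  quantifierChain (wfInd i)  = QuantifierChain-[]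
  quantifierChain (wf¬ wfψ)  = quantifierChain wfψ
  quantifierChain (wf∧ {ψ} {φ} wfψ wfφ ψ≺φ φ≺ψ) with ≤-total (depth ψ) (depth φ)
  ... | inj₁ ψ≤φ =
    subst (QuantifierChain _ _) (sym (m≤n⇒m⊔n≡n ψ≤φ)) (QuantifierChain-++ˡ (quantifierChain wfφ) ψ≺φ)
  ... | inj₂ φ≤ψ =
    subst (QuantifierChain _ _) (sym (m≥n⇒m⊔n≡m φ≤ψ)) (QuantifierChain-++ʳ (quantifierChain wfψ) φ≺ψ)
  quantifierChain (wf∃ {ψ = ψ} wfψ i∈Fr) = QuantifierChain-bind (quantifierChain wfψ) i∈Fr (Fr⊆Var ψ i∈Fr)
  quantifierChain (wf∀ {ψ = ψ} wfψ i∈Fr) = QuantifierChain-bind (quantifierChain wfψ) i∈Fr (Fr⊆Var ψ i∈Fr)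

  depth≤numVars : ∀ {ψ} → WellFormed ψ → depth ψ ≤ numVars ψ
  depth≤numVars {ψ} wfψ = subst (_≤ numVars ψ) length≡depth
    (length-mono-⊆ unique (λ k∈ → ∈-deduplicate⁺ _≟_ (bound⊆vars k∈)))
    where open QuantifierChain (quantifierChain wfψ)

module Transfer where
  open Cells
  open Similarity
  open QuantifierDepth using (depth)
  open import Data.Bool using (true; false; T)
  open import Data.Fin.Subset using (Subset; ⊤; ∣_∣)
  open import Data.Fin.Subset.Properties using (∣⊤∣≡n)
  open import Data.List using (List; _∷_; filter)
  open import Data.List.Membership.Propositional using () renaming (_∈_ to _∈ˡ_)
  open import Data.List.Membership.Propositional.Properties using (∈-filter⁺; ∈-filter⁻; ∈-++⁺ˡ; ∈-++⁺ʳ)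
  open import Data.List.Relation.Binary.Subset.Propositional using () renaming (_⊆_ to _⊆ˡ_)
  open import Data.List.Relation.Binary.Sublist.Propositional as Sublist using (minimum)
  open import Data.List.Relation.Binary.Sublist.Propositional.Properties using (filter-⊆)
  open import Data.List.Relation.Unary.Any using (here; there)
  open import Data.Nat using (ℕ; zero; suc; _+_; _<_; _≤_; z≤n; s≤s; _≟_)
  open import Data.Nat.Properties
  open import Data.Product using (∃; _,_; proj₂)
  open import Function.Bundles using (_⇔_; Equivalence)
  open import Relation.Binary.PropositionalEquality
  open import Relation.Nullary using (¬?; yes; no)
  open import Relation.Nullary.Negation using (contradiction)

  private variable
    m n : ℕ

  -- Atomic formulas compare sizes with 0, 1 and r; each quantifier halves the threshold.
  threshold : ℕ → ℕ → ℕ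
  threshold r zero    = 2 + r
  threshold r (suc d) = threshold r d + threshold r d

  2+r≤threshold : ∀ r d → 2 + r ≤ threshold r d
  2+r≤threshold r zero    = ≤-refl
  2+r≤threshold r (suc d) = ≤-trans (2+r≤threshold r d) (m≤m+n _ _)

  IsUniform : ℕ → Matroid n → Set
  IsUniform r M = ∀ X → T (indep M X) ⇔ ∣ X ∣ ≤ r

  update-≡ : ∀ (M : Matroid n) ρ i X → update M ρ i X i ≡ X
  update-≡ M ρ i X with i ≟ i
  ... | yes _  = refl
  ... | no i≢i = contradiction refl i≢i

  update-≢ : ∀ (M : Matroid n) ρ {i} X {k} → k ≢ i → update M ρ i X k ≡ ρ k
  update-≢ M ρ {i} X {k} k≢i with k ≟ i
  ... | yes k≡i = contradiction k≡i k≢i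
  ... | no _    = refl

  without : ℕ → List ℕ → List ℕ
  without i = filter (λ k → ¬? (k ≟ i))

  module _ {T : ℕ} {ρ : ℕ → Subset m} {ρ' : ℕ → Subset n} {V : List ℕ} where

    Similar⇒∣ρ∣≃ : ∀ {i} → i ∈ˡ V → Similar T ρ ρ' V ⊤ ⊤ → ∣ ρ i ∣ ≃[ T ] ∣ ρ' i ∣
    Similar⇒∣ρ∣≃ {i} i∈V sim = subst₂ (λ A B → ∣ A ∣ ≃[ T ] ∣ B ∣) (⊤∩[true]p≡p (ρ i)) (⊤∩[true]p≡p (ρ' i))
      (Similar-sublist (minimum V) (Similar-refine i∈V sim true))

    Similar⇒∣ρ─ρ∣≃ : ∀ {i j} → i ∈ˡ V → j ∈ˡ V → Similar T ρ ρ' V ⊤ ⊤ →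
                     ∣ ρ i ∩[ false ] ρ j ∣ ≃[ T ] ∣ ρ' i ∩[ false ] ρ' j ∣
    Similar⇒∣ρ─ρ∣≃ {i} {j} i∈V j∈V sim =
      subst₂ (λ A B → ∣ A ∩[ false ] ρ j ∣ ≃[ T ] ∣ B ∩[ false ] ρ' j ∣)
             (⊤∩[true]p≡p (ρ i)) (⊤∩[true]p≡p (ρ' i))
        (Similar-sublist (minimum V) (Similar-refine j∈V (Similar-refine i∈V sim true) false))

  Similar-update : ∀ {T} (M : Matroid m) (M' : Matroid n) {ρ ρ' V} i →
                   Similar (T + T) ρ ρ' V ⊤ ⊤ → ∀ X → ∃ λ X' →
                   Similar T (update M ρ i X) (update M' ρ' i X') (i ∷ without i V) ⊤ ⊤
  Similar-update {T = T} M M' {ρ} {ρ'} {V} i sim X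
    with Similar-split (without i V) (Similar-sublist (filter-⊆ (λ k → ¬? (k ≟ i)) V) sim) X
  ... | X' , sim' = X' , λ b →
    subst₂ (λ A B → Similar T (update M ρ i X) (update M' ρ' i X') (without i V) (⊤ ∩[ b ] A) (⊤ ∩[ b ] B))
           (sym (update-≡ M ρ i X)) (sym (update-≡ M' ρ' i X'))
           (Similar-cong (without i V) (λ k∈ → sym (update-≢ M ρ X (≢i k∈)))
                                       (λ k∈ → sym (update-≢ M' ρ' X' (≢i k∈))) (sim' b))
    where
    ≢i : ∀ {k} → k ∈ˡ without i V → k ≢ i
    ≢i k∈ = proj₂ (∈-filter⁻ (λ k → ¬? (k ≟ i)) {xs = V} k∈)

  Fr-body-scope : ∀ i ψ {V} → Fr (∃′ i ψ) ⊆ˡ V → Fr ψ ⊆ˡ i ∷ without i V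
  Fr-body-scope i ψ fr {k} k∈Frψ with k ≟ i
  ... | yes refl = here refl
  ... | no k≢i   = there (∈-filter⁺ (λ k → ¬? (k ≟ i)) (fr (∈-filter⁺ (λ k → ¬? (k ≟ i)) k∈Frψ k≢i)) k≢i)

  Sat-transfer : ∀ {r} {M : Matroid m} {M' : Matroid n} → IsUniform r M → IsUniform r M' →
                 ∀ ψ {d V ρ ρ'} → depth ψ ≤ d → Fr ψ ⊆ˡ V → Similar (threshold r d) ρ ρ' V ⊤ ⊤ →
                 Sat M ρ ψ → Sat M' ρ' ψ
  Sat-transfer {r = r} _ _ (i ⊆′ j) {d} _ fr sim ρi⊆ρj =
    ∣p∩[false]q∣≡0⇒p⊆q (≃-below (≤-trans (s≤s z≤n) (2+r≤threshold r d)) (p⊆q⇒∣p∩[false]q∣≡0 ρi⊆ρj)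
                                (Similar⇒∣ρ─ρ∣≃ (fr (here refl)) (fr (there (here refl))) sim))
  Sat-transfer {r = r} _ _ (Sing i) {d} _ fr sim ∣ρi∣≡1 =
    ≃-below (≤-trans (s≤s (s≤s z≤n)) (2+r≤threshold r d)) ∣ρi∣≡1 (Similar⇒∣ρ∣≃ (fr (here refl)) sim)
  Sat-transfer {r = r} uM uM' (Ind i) {d} {ρ = ρ} _ fr sim indep-ρi =
    Equivalence.from (uM' _)
      (subst (_≤ r) (sym (≃-below ∣ρi∣<T refl (Similar⇒∣ρ∣≃ (fr (here refl)) sim))) ∣ρi∣≤r)
    where
    ∣ρi∣≤r : ∣ ρ i ∣ ≤ r
    ∣ρi∣≤r = Equivalence.to (uM (ρ i)) indep-ρi
    ∣ρi∣<T : ∣ ρ i ∣ < threshold r d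
    ∣ρi∣<T = ≤-trans (s≤s ∣ρi∣≤r) (≤-trans (n≤1+n _) (2+r≤threshold r d))
  Sat-transfer uM uM' (¬′ ψ) {V = V} dep fr sim ¬sat sat' =
    ¬sat (Sat-transfer uM' uM ψ dep fr (Similar-sym V sim) sat')
  Sat-transfer uM uM' (ψ ∧′ φ) dep fr sim (satψ , satφ) =
    Sat-transfer uM uM' ψ (m⊔n≤o⇒m≤o (depth ψ) _ dep) (λ k∈ → fr (∈-++⁺ˡ k∈)) sim satψ ,
    Sat-transfer uM uM' φ (m⊔n≤o⇒n≤o (depth ψ) _ dep) (λ k∈ → fr (∈-++⁺ʳ (Fr ψ) k∈)) sim satφ
  Sat-transfer {M = M} {M'} uM uM' (∃′ i ψ) {suc d} (s≤s dep) fr sim (X , sat)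
    with Similar-update M M' i sim X
  ... | X' , sim' = X' , Sat-transfer uM uM' ψ dep (Fr-body-scope i ψ fr) sim' sat
  Sat-transfer {M = M} {M'} uM uM' (∀′ i ψ) {suc d} {V} (s≤s dep) fr sim sat X'
    with Similar-update M' M i (Similar-sym V sim) X'
  ... | X , sim' =
    Sat-transfer uM uM' ψ dep (Fr-body-scope i ψ fr) (Similar-sym (i ∷ without i V) sim') (sat X)

  Satisfies-transfer : ∀ {r d ψ} {M : Matroid m} {M' : Matroid n} → IsUniform r M → IsUniform r M' →
                       IsSentence ψ → depth ψ ≤ d → threshold r d ≤ m → threshold r d ≤ n →
                       Satisfies M ψ → Satisfies M' ψ
  Satisfies-transfer {m} {n} {ψ = ψ} uM uM' (_ , Frψ≡[]) dep T≤m T≤n =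
    Sat-transfer uM uM' ψ dep (λ k∈ → subst (_ ∈ˡ_) Frψ≡[] k∈)
      (large (subst (_ ≤_) (sym (∣⊤∣≡n m)) T≤m) (subst (_ ≤_) (sym (∣⊤∣≡n n)) T≤n))

module UniformMatroids where
  open Transfer using (IsUniform)
  open import Data.Bool using (true; false; T)
  open import Data.Fin using (Fin; zero; suc)
  open import Data.Fin.Subset using (Subset; ⊥; ⁅_⁆; _∪_; _∈_; _∉_; _⊆_; ∣_∣)
  open import Data.Fin.Subset.Properties
    using (∉⊥; ∣⊥∣≡0; ∣⁅x⁆∣≡1; x∈⁅x⁆; x∈⁅y⁆⇒x≡y; x∈p∪q⁺; x∈p∪q⁻; p⊆q⇒∣p∣≤∣q∣; ∪-identityˡ)
  open import Data.Nat using (ℕ; zero; suc; _<_; _≤_; _≤ᵇ_; z≤n; s≤s)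
  open import Data.Nat.Properties using (≤-trans; ≤ᵇ⇒≤; ≤⇒≤ᵇ; n≤1+n)
  open import Data.Product using (∃; _×_; _,_)
  open import Data.Sum using (_⊎_; inj₁; inj₂)
  open import Data.Vec using (_∷_; here; there)
  open import Function.Bundles using (mk⇔)
  open import Relation.Binary.PropositionalEquality using (_≡_; _≢_; refl; sym; trans; cong; subst)
  open import Relation.Nullary.Negation using (contradiction)

  private variable
    n : ℕ

  ∃∈∉-there : ∀ {a b} {p q : Subset n} → (∃ λ x → x ∈ q × x ∉ p) → ∃ λ x → x ∈ b ∷ q × x ∉ a ∷ p
  ∃∈∉-there (x , x∈q , x∉p) = suc x , there x∈q , λ { (there x∈p) → x∉p x∈p }

  ∣p∣<∣q∣⇒∃∈q∉p : ∀ {p q : Subset n} → ∣ p ∣ < ∣ q ∣ → ∃ λ x → x ∈ q × x ∉ p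
  ∣p∣<∣q∣⇒∃∈q∉p {p = false ∷ p} {true ∷ q}  _        = zero , here , λ ()
  ∣p∣<∣q∣⇒∃∈q∉p {p = true ∷ p}  {true ∷ q}  (s≤s lt) = ∃∈∉-there (∣p∣<∣q∣⇒∃∈q∉p lt)
  ∣p∣<∣q∣⇒∃∈q∉p {p = false ∷ p} {false ∷ q} lt       = ∃∈∉-there (∣p∣<∣q∣⇒∃∈q∉p lt)
  ∣p∣<∣q∣⇒∃∈q∉p {p = true ∷ p}  {false ∷ q} lt       = ∃∈∉-there (∣p∣<∣q∣⇒∃∈q∉p (≤-trans (n≤1+n _) lt))

  ∣⁅x⁆∪p∣≡1+∣p∣ : ∀ {x} {p : Subset n} → x ∉ p → ∣ ⁅ x ⁆ ∪ p ∣ ≡ suc ∣ p ∣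
  ∣⁅x⁆∪p∣≡1+∣p∣ {x = zero}  {true ∷ p}  x∉p = contradiction here x∉p
  ∣⁅x⁆∪p∣≡1+∣p∣ {x = zero}  {false ∷ p} x∉p = cong suc (cong ∣_∣ (∪-identityˡ p))
  ∣⁅x⁆∪p∣≡1+∣p∣ {x = suc x} {true ∷ p}  x∉p = cong suc (∣⁅x⁆∪p∣≡1+∣p∣ (λ x∈p → x∉p (there x∈p)))
  ∣⁅x⁆∪p∣≡1+∣p∣ {x = suc x} {false ∷ p} x∉p = ∣⁅x⁆∪p∣≡1+∣p∣ (λ x∈p → x∉p (there x∈p))

  uniform : ℕ → ∀ n → Matroid n
  uniform r n = record
    { indep = λ X → ∣ X ∣ ≤ᵇ r
    ; I1    = ≤⇒≤ᵇ (subst (_≤ r) (sym (∣⊥∣≡0 n)) z≤n)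
    ; I2    = λ X⊆Y Y-indep → ≤⇒≤ᵇ (≤-trans (p⊆q⇒∣p∣≤∣q∣ X⊆Y) (≤ᵇ⇒≤ _ r Y-indep))
    ; I3    = augment
    }
    where
    augment : ∀ {X Y : Subset n} → T (∣ X ∣ ≤ᵇ r) → T (∣ Y ∣ ≤ᵇ r) → ∣ X ∣ < ∣ Y ∣ →
              ∃ λ e → e ∈ Y × e ∉ X × T (∣ ⁅ e ⁆ ∪ X ∣ ≤ᵇ r)
    augment {X} {Y} _ Y-indep ∣X∣<∣Y∣ with ∣p∣<∣q∣⇒∃∈q∉p ∣X∣<∣Y∣
    ... | e , e∈Y , e∉X =
      e , e∈Y , e∉X , ≤⇒≤ᵇ (subst (_≤ r) (sym (∣⁅x⁆∪p∣≡1+∣p∣ e∉X)) (≤-trans ∣X∣<∣Y∣ (≤ᵇ⇒≤ _ r Y-indep)))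

  uniform-isUniform : ∀ r n → IsUniform r (uniform r n)
  uniform-isUniform r n X = mk⇔ (≤ᵇ⇒≤ _ r) ≤⇒≤ᵇ

  pair : Fin n → Fin n → Subset n
  pair a b = ⁅ a ⁆ ∪ ⁅ b ⁆

  triple : Fin n → Fin n → Fin n → Subset n
  triple a b k = ⁅ a ⁆ ∪ pair b k

  x∈⁅x⁆∪p : ∀ (x : Fin n) {p} → x ∈ ⁅ x ⁆ ∪ p
  x∈⁅x⁆∪p x = x∈p∪q⁺ (inj₁ (x∈⁅x⁆ x))

  x∈p⇒x∈⁅y⁆∪p : ∀ {x} (y : Fin n) {p} → x ∈ p → x ∈ ⁅ y ⁆ ∪ p
  x∈p⇒x∈⁅y⁆∪p y x∈p = x∈p∪q⁺ (inj₂ x∈p)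

  x∈⁅y⁆∪p⁻ : ∀ {x} (y : Fin n) {p} → x ∈ ⁅ y ⁆ ∪ p → x ≡ y ⊎ x ∈ p
  x∈⁅y⁆∪p⁻ y {p} x∈ with x∈p∪q⁻ ⁅ y ⁆ p x∈
  ... | inj₁ x∈⁅y⁆ = inj₁ (x∈⁅y⁆⇒x≡y y x∈⁅y⁆)
  ... | inj₂ x∈p   = inj₂ x∈p

  x∈pair⁻ : ∀ {x a b : Fin n} → x ∈ pair a b → x ≡ a ⊎ x ≡ b
  x∈pair⁻ {a = a} {b} x∈ with x∈⁅y⁆∪p⁻ a x∈
  ... | inj₁ x≡a   = inj₁ x≡a
  ... | inj₂ x∈⁅b⁆ = inj₂ (x∈⁅y⁆⇒x≡y b x∈⁅b⁆)

  x∈triple⁻ : ∀ {x a b k : Fin n} → x ∈ triple a b k → x ≡ a ⊎ x ≡ b ⊎ x ≡ k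
  x∈triple⁻ {a = a} x∈ with x∈⁅y⁆∪p⁻ a x∈
  ... | inj₁ x≡a     = inj₁ x≡a
  ... | inj₂ x∈pair = inj₂ (x∈pair⁻ x∈pair)

  ∣pair∣≡2 : ∀ {a b : Fin n} → a ≢ b → ∣ pair a b ∣ ≡ 2
  ∣pair∣≡2 {a = a} {b} a≢b = trans (∣⁅x⁆∪p∣≡1+∣p∣ a∉⁅b⁆) (cong suc (∣⁅x⁆∣≡1 b))
    where
    a∉⁅b⁆ : a ∉ ⁅ b ⁆
    a∉⁅b⁆ a∈⁅b⁆ = a≢b (x∈⁅y⁆⇒x≡y b a∈⁅b⁆)

  ∣triple∣≡3 : ∀ {a b k : Fin n} → a ≢ b → a ≢ k → b ≢ k → ∣ triple a b k ∣ ≡ 3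
  ∣triple∣≡3 {a = a} {b} {k} a≢b a≢k b≢k = trans (∣⁅x⁆∪p∣≡1+∣p∣ a∉pair-b-k) (cong suc (∣pair∣≡2 b≢k))
    where
    a∉pair-b-k : a ∉ pair b k
    a∉pair-b-k a∈ with x∈pair⁻ a∈
    ... | inj₁ a≡b = a≢b a≡b
    ... | inj₂ a≡k = a≢k a≡k

  distinct₃⇒3≤∣p∣ : ∀ {a b k : Fin n} {X} → a ∈ X → b ∈ X → k ∈ X → a ≢ b → a ≢ k → b ≢ k → 3 ≤ ∣ X ∣
  distinct₃⇒3≤∣p∣ {a = a} {b} {k} a∈X b∈X k∈X a≢b a≢k b≢k =
    subst (_≤ _) (∣triple∣≡3 a≢b a≢k b≢k) (p⊆q⇒∣p∣≤∣q∣ triple⊆X)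
    where
    triple⊆X : triple a b k ⊆ _
    triple⊆X x∈ with x∈triple⁻ x∈
    ... | inj₁ refl        = a∈X
    ... | inj₂ (inj₁ refl) = b∈X
    ... | inj₂ (inj₂ refl) = k∈X

  3≤∣p∣⇒distinct₃ : ∀ {X : Subset n} → 3 ≤ ∣ X ∣ →
                    ∃ λ a → ∃ λ b → ∃ λ k → a ∈ X × b ∈ X × k ∈ X × a ≢ b × a ≢ k × b ≢ k
  3≤∣p∣⇒distinct₃ {n} {X} 3≤∣X∣
    with ∣p∣<∣q∣⇒∃∈q∉p {p = ⊥} (subst (_< ∣ X ∣) (sym (∣⊥∣≡0 n)) (≤-trans (s≤s z≤n) 3≤∣X∣))
  ... | a , a∈X , _
    with ∣p∣<∣q∣⇒∃∈q∉p (subst (_< ∣ X ∣) (sym (∣⁅x⁆∣≡1 a)) (≤-trans (s≤s (s≤s z≤n)) 3≤∣X∣))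
  ... | b , b∈X , b∉⁅a⁆
    with ∣p∣<∣q∣⇒∃∈q∉p (subst (_< ∣ X ∣) (sym (∣pair∣≡2 b≢a)) 3≤∣X∣)
    where
    b≢a : b ≢ a
    b≢a refl = b∉⁅a⁆ (x∈⁅x⁆ b)
  ... | k , k∈X , k∉pair =
    a , b , k , a∈X , b∈X , k∈X ,
    (λ { refl → b∉⁅a⁆ (x∈⁅x⁆ a) }) ,
    (λ { refl → k∉pair (x∈p⇒x∈⁅y⁆∪p b (x∈⁅x⁆ a)) }) ,
    (λ { refl → k∉pair (x∈⁅x⁆∪p b) })

module FieldFacts (F : Field) where
  open import Algebra.Bundles using (CommutativeRing)
  open import Data.Fin using (Fin; zero; suc; _≟_)
  open import Data.Nat using (ℕ; zero; suc)
  open import Data.Product using (_,_)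
  open import Function using (_∘_)
  open import Relation.Binary.PropositionalEquality as ≡ using (_≡_; _≢_)
  open import Relation.Nullary using (¬_; yes; no)
  open import Relation.Nullary.Negation using (contradiction)

  open Field F using (0≉1; inverse)
  open CommutativeRing (Field.commRing F) hiding (zero)
  open import Algebra.Properties.Ring ring public using (-‿distribˡ-*; -‿distribʳ-*; -1*x≈-x)
  open import Algebra.Properties.Ring ring using ([y-z]x≈yx-zx)
  open import Algebra.Properties.Group +-group public using (x∙y⁻¹≈ε⇒x≈y)
  open import Algebra.Properties.Group +-group using (inverseʳ-unique; ⁻¹-involutive; ε⁻¹≈ε)
  open import Algebra.Properties.AbelianGroup +-abelianGroup using (⁻¹-∙-comm)
  open import Algebra.Properties.CommutativeSemigroup +-commutativeSemigroup using (xy∙z≈xz∙y)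
  open import Algebra.Properties.CommutativeSemigroup *-commutativeSemigroup
    using () renaming (interchange to *-interchange)
  open import Algebra.Properties.Semiring.Sum semiring using (sum; sum-cong-≋; sum-replicate-zero; ∑-distrib-+; *-distribˡ-sum)
  open import Relation.Binary.Reasoning.Setoid setoid public

  private variable
    n r : ℕ

  x*y≈0⇒x≈0 : ∀ {x y} → x * y ≈ 0# → ¬ y ≈ 0# → x ≈ 0#
  x*y≈0⇒x≈0 {x} {y} xy≈0 y≉0 with inverse y y≉0
  ... | y⁻¹ , yy⁻¹≈1 = begin
    x              ≈⟨ *-identityʳ x ⟨
    x * 1#         ≈⟨ *-congˡ yy⁻¹≈1 ⟨
    x * (y * y⁻¹)  ≈⟨ *-assoc x y y⁻¹ ⟨
    x * y * y⁻¹    ≈⟨ *-congʳ xy≈0 ⟩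
    0# * y⁻¹       ≈⟨ zeroˡ y⁻¹ ⟩
    0#             ∎

  -x≉0 : ∀ {x} → ¬ x ≈ 0# → ¬ - x ≈ 0#
  -x≉0 {x} x≉0 -x≈0 = x≉0 (trans (sym (⁻¹-involutive x)) (trans (-‿cong -x≈0) ε⁻¹≈ε))

  1≉0 : ¬ 1# ≈ 0#
  1≉0 1≈0 = 0≉1 (sym 1≈0)

  telescope : ∀ x y z → (x - y) + (y - z) ≈ x - z
  telescope x y z = begin
    (x - y) + (y - z)       ≈⟨ +-assoc x (- y) (y - z) ⟩
    x + (- y + (y - z))     ≈⟨ +-congˡ (+-assoc (- y) y (- z)) ⟨
    x + ((- y + y) + - z)   ≈⟨ +-congˡ (+-congʳ (-‿inverseˡ y)) ⟩
    x + (0# + - z)          ≈⟨ +-congˡ (+-identityˡ (- z)) ⟩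
    x - z                   ∎

  cyclic-difference : ∀ x y z → (x - y) + (y - z) + (z - x) ≈ 0#
  cyclic-difference x y z = trans (+-congʳ (telescope x y z)) (trans (telescope x z x) (-‿inverseʳ x))

  cyclic-product : ∀ x y z → (y - z) * x + (z - x) * y + (x - y) * z ≈ 0#
  cyclic-product x y z = begin
    (y - z) * x + (z - x) * y + (x - y) * z
      ≈⟨ +-cong (+-cong ([y-z]x≈yx-zx x y z) ([y-z]x≈yx-zx y z x)) ([y-z]x≈yx-zx z x y) ⟩
    (y * x - z * x) + (z * y - x * y) + (x * z - y * z)
      ≈⟨ +-cong (+-cong (+-congˡ (-‿cong (*-comm z x))) (+-congˡ (-‿cong (*-comm x y))))
                (+-congˡ (-‿cong (*-comm y z))) ⟩
    (y * x - x * z) + (z * y - y * x) + (x * z - z * y)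
      ≈⟨ xy∙z≈xz∙y _ _ _ ⟩
    (y * x - x * z) + (x * z - z * y) + (z * y - y * x)
      ≈⟨ cyclic-difference (y * x) (x * z) (z * y) ⟩
    0# ∎

  ∑ : (Fin n → Carrier) → Carrier
  ∑ = Σ[_] F

  ∑≡sum : ∀ (f : Fin n → Carrier) → ∑ f ≡ sum f
  ∑≡sum {zero}  f = ≡.refl
  ∑≡sum {suc n} f = ≡.cong (f zero +_) (∑≡sum (f ∘ suc))

  ∑-cong : ∀ {f g : Fin n → Carrier} → (∀ j → f j ≈ g j) → ∑ f ≈ ∑ g
  ∑-cong {f = f} {g} f≈g = begin
    ∑ f    ≡⟨ ∑≡sum f ⟩
    sum f  ≈⟨ sum-cong-≋ f≈g ⟩
    sum g  ≡⟨ ∑≡sum g ⟨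
    ∑ g    ∎

  ∑-+ : ∀ (f g : Fin n → Carrier) → ∑ (λ j → f j + g j) ≈ ∑ f + ∑ g
  ∑-+ f g = begin
    ∑ (λ j → f j + g j)    ≡⟨ ∑≡sum (λ j → f j + g j) ⟩
    sum (λ j → f j + g j)  ≈⟨ ∑-distrib-+ f g ⟩
    sum f + sum g          ≡⟨ ≡.cong₂ _+_ (∑≡sum f) (∑≡sum g) ⟨
    ∑ f + ∑ g              ∎

  ∑-*ˡ : ∀ x (f : Fin n → Carrier) → x * ∑ f ≈ ∑ (λ j → x * f j)
  ∑-*ˡ x f = begin
    x * ∑ f              ≡⟨ ≡.cong (x *_) (∑≡sum f) ⟩
    x * sum f            ≈⟨ *-distribˡ-sum x f ⟩
    sum (λ j → x * f j)  ≡⟨ ∑≡sum (λ j → x * f j) ⟨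
    ∑ (λ j → x * f j)    ∎

  δ : Fin n → Carrier → Fin n → Carrier
  δ zero    x zero    = x
  δ zero    x (suc j) = 0#
  δ (suc i) x zero    = 0#
  δ (suc i) x (suc j) = δ i x j

  δ-diag : ∀ (i : Fin n) x → δ i x i ≡ x
  δ-diag zero    x = ≡.refl
  δ-diag (suc i) x = δ-diag i x

  δ-off : ∀ (i : Fin n) x j → j ≢ i → δ i x j ≡ 0#
  δ-off zero    x zero    j≢i = contradiction ≡.refl j≢i
  δ-off zero    x (suc j) j≢i = ≡.refl
  δ-off (suc i) x zero    j≢i = ≡.refl
  δ-off (suc i) x (suc j) j≢i = δ-off i x j (λ j≡i → j≢i (≡.cong suc j≡i))

  ∑-zero : ∀ {f : Fin n → Carrier} → (∀ j → f j ≈ 0#) → ∑ f ≈ 0#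
  ∑-zero {n} f≈0 = trans (∑-cong f≈0) (trans (reflexive (∑≡sum {n} (λ _ → 0#))) (sum-replicate-zero n))

  ∑-δ : ∀ (i : Fin n) x → ∑ (δ i x) ≈ x
  ∑-δ {suc n} zero    x = trans (+-congˡ (∑-zero {n} {λ _ → 0#} (λ _ → refl))) (+-identityʳ x)
  ∑-δ         (suc i) x = trans (+-identityˡ _) (∑-δ i x)

  ∑-vanishes-off₁ : ∀ {f : Fin n → Carrier} a → (∀ j → j ≢ a → f j ≈ 0#) → ∑ f ≈ f a
  ∑-vanishes-off₁ {f = f} a off = trans (∑-cong decompose) (∑-δ a (f a))
    where
    decompose : ∀ j → f j ≈ δ a (f a) j
    decompose j with j ≟ a
    ... | yes ≡.refl = reflexive (≡.sym (δ-diag a (f a)))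
    ... | no  j≢a    = trans (off j j≢a) (reflexive (≡.sym (δ-off a (f a) j j≢a)))

  ∑-vanishes-off₃ : ∀ {f : Fin n → Carrier} {a b k} → a ≢ b → a ≢ k → b ≢ k →
                    (∀ j → j ≢ a → j ≢ b → j ≢ k → f j ≈ 0#) → ∑ f ≈ f a + f b + f k
  ∑-vanishes-off₃ {f = f} {a} {b} {k} a≢b a≢k b≢k off = begin
    ∑ f                                                  ≈⟨ ∑-cong decompose ⟩
    ∑ (λ j → δ a (f a) j + δ b (f b) j + δ k (f k) j)    ≈⟨ ∑-+ _ (δ k (f k)) ⟩
    ∑ (λ j → δ a (f a) j + δ b (f b) j) + ∑ (δ k (f k))  ≈⟨ +-congʳ (∑-+ (δ a (f a)) (δ b (f b))) ⟩
    ∑ (δ a (f a)) + ∑ (δ b (f b)) + ∑ (δ k (f k))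
      ≈⟨ +-cong (+-cong (∑-δ a (f a)) (∑-δ b (f b))) (∑-δ k (f k)) ⟩
    f a + f b + f k                                      ∎
    where
    at : ∀ j {x y z} → δ a (f a) j ≡ x → δ b (f b) j ≡ y → δ k (f k) j ≡ z →
         δ a (f a) j + δ b (f b) j + δ k (f k) j ≈ x + y + z
    at j ≡x ≡y ≡z = reflexive (≡.cong₂ _+_ (≡.cong₂ _+_ ≡x ≡y) ≡z)
    decompose : ∀ j → f j ≈ δ a (f a) j + δ b (f b) j + δ k (f k) j
    decompose j with j ≟ a | j ≟ b | j ≟ k
    ... | yes ≡.refl | _          | _          =
      sym (trans (at a (δ-diag a (f a)) (δ-off b (f b) a a≢b) (δ-off k (f k) a a≢k))
                 (trans (+-identityʳ _) (+-identityʳ _)))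
    ... | no j≢a     | yes ≡.refl | _          =
      sym (trans (at b (δ-off a (f a) b j≢a) (δ-diag b (f b)) (δ-off k (f k) b b≢k))
                 (trans (+-identityʳ _) (+-identityˡ _)))
    ... | no j≢a     | no j≢b     | yes ≡.refl =
      sym (trans (at k (δ-off a (f a) k j≢a) (δ-off b (f b) k j≢b) (δ-diag k (f k)))
                 (trans (+-congʳ (+-identityʳ 0#)) (+-identityˡ _)))
    ... | no j≢a     | no j≢b     | no j≢k     =
      trans (off j j≢a j≢b j≢k)
            (sym (trans (at j (δ-off a (f a) j j≢a) (δ-off b (f b) j j≢b) (δ-off k (f k) j j≢k))
                        (trans (+-identityʳ _) (+-identityʳ 0#))))

  infixl 7 _·_

  _·_ : (Fin r → Fin n → Carrier) → (Fin n → Carrier) → Fin r → Carrier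
  (A · c) i = ∑ (λ j → c j * A i j)

  ·-+ : ∀ (A : Fin r → Fin n → Carrier) c d i → (A · (λ j → c j + d j)) i ≈ (A · c) i + (A · d) i
  ·-+ A c d i =
    trans (∑-cong (λ j → distribʳ (A i j) (c j) (d j))) (∑-+ (λ j → c j * A i j) (λ j → d j * A i j))

  ·-δ : ∀ (A : Fin r → Fin n → Carrier) a x i → (A · δ a x) i ≈ x * A i a
  ·-δ A a x i =
    trans (∑-vanishes-off₁ a (λ j j≢a → trans (*-congʳ (reflexive (δ-off a x j j≢a))) (zeroˡ (A i j))))
                      (*-congʳ (reflexive (δ-diag a x)))

  ·-δ₂ : ∀ (A : Fin r → Fin n → Carrier) a b x y i →
         (A · (λ j → δ a x j + δ b y j)) i ≈ x * A i a + y * A i b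
  ·-δ₂ A a b x y i = trans (·-+ A (δ a x) (δ b y) i) (+-cong (·-δ A a x i) (·-δ A b y i))

  ·-δ₃ : ∀ (A : Fin r → Fin n → Carrier) a b k x y z i →
         (A · (λ j → δ a x j + δ b y j + δ k z j)) i ≈ x * A i a + y * A i b + z * A i k
  ·-δ₃ A a b k x y z i =
    trans (·-+ A (λ j → δ a x j + δ b y j) (δ k z) i) (+-cong (·-δ₂ A a b x y i) (·-δ A k z i))

  scale-combination : ∀ w s u a b → w * (s * a + u * b) ≈ (w * s) * a + (w * u) * b
  scale-combination w s u a b =
    trans (distribˡ w (s * a) (u * b)) (+-cong (sym (*-assoc w s a)) (sym (*-assoc w u b)))

  solve-linear : ∀ {x x⁻¹ u z} → x * x⁻¹ ≈ 1# → u + x * z ≈ 0# → z ≈ - (x⁻¹ * u)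
  solve-linear {x} {x⁻¹} {u} {z} xx⁻¹≈1 u+xz≈0 = begin
    z                ≈⟨ *-identityˡ z ⟨
    1# * z           ≈⟨ *-congʳ (trans (*-comm x⁻¹ x) xx⁻¹≈1) ⟨
    x⁻¹ * x * z      ≈⟨ *-assoc x⁻¹ x z ⟩
    x⁻¹ * (x * z)    ≈⟨ *-congˡ (inverseʳ-unique u (x * z) u+xz≈0) ⟩
    x⁻¹ * - u        ≈⟨ -‿distribʳ-* x⁻¹ u ⟨
    - (x⁻¹ * u)      ∎

  -‿scale-combination : ∀ w s u a b → - (w * (s * a + u * b)) ≈ - (w * s) * a + - (w * u) * b
  -‿scale-combination w s u a b = begin
    - (w * (s * a + u * b))            ≈⟨ -‿cong (scale-combination w s u a b) ⟩
    - ((w * s) * a + (w * u) * b)      ≈⟨ ⁻¹-∙-comm _ _ ⟨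
    - ((w * s) * a) + - ((w * u) * b)  ≈⟨ +-cong (-‿distribˡ-* _ a) (-‿distribˡ-* _ b) ⟩
    - (w * s) * a + - (w * u) * b      ∎

  cross-multiply : ∀ {s u s' u' v v'} → u * v ≈ 1# → u' * v' ≈ 1# → s * v ≈ s' * v' → u' * s ≈ u * s'
  cross-multiply {s} {u} {s'} {u'} {v} {v'} uv≈1 u'v'≈1 sv≈s'v' = begin
    u' * s                ≈⟨ *-identityʳ _ ⟨
    u' * s * 1#           ≈⟨ *-congˡ uv≈1 ⟨
    u' * s * (u * v)      ≈⟨ *-interchange u' s u v ⟩
    u' * u * (s * v)      ≈⟨ *-cong (*-comm u' u) sv≈s'v' ⟩
    u * u' * (s' * v')    ≈⟨ *-interchange u u' s' v' ⟩
    u * s' * (u' * v')    ≈⟨ *-congˡ u'v'≈1 ⟩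
    u * s' * 1#           ≈⟨ *-identityʳ _ ⟩
    u * s'                ∎

  proportional-combinations : ∀ {a b x x' s u s' u'} → x ≈ s * a + u * b → x' ≈ s' * a + u' * b →
                              u' * s ≈ u * s' → u' * x + - u * x' ≈ 0#
  proportional-combinations {a} {b} {x} {x'} {s} {u} {s'} {u'} x≈ x'≈ u's≈us' = begin
    u' * x + - u * x'
      ≈⟨ +-cong (*-congˡ x≈) (sym (-‿distribˡ-* u x')) ⟩
    u' * (s * a + u * b) + - (u * x')
      ≈⟨ +-cong (scale-combination u' s u a b) (-‿cong (*-congˡ x'≈)) ⟩
    (u' * s) * a + (u' * u) * b + - (u * (s' * a + u' * b))
      ≈⟨ +-cong (+-cong (*-congʳ u's≈us') (*-congʳ (*-comm u' u))) (-‿cong (scale-combination u s' u' a b)) ⟩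
    (u * s') * a + (u * u') * b + - ((u * s') * a + (u * u') * b)
      ≈⟨ -‿inverseʳ _ ⟩
    0#                                                   ∎

module Representations where
  open QuantifierDepth using (depth≤numVars)
  open Transfer using (threshold; Satisfies-transfer)
  open UniformMatroids
    using (uniform; uniform-isUniform; pair; triple; ∣pair∣≡2; ∣triple∣≡3; distinct₃⇒3≤∣p∣; 3≤∣p∣⇒distinct₃;
           x∈⁅x⁆∪p; x∈p⇒x∈⁅y⁆∪p; x∈triple⁻)
  open import Algebra.Bundles using (CommutativeRing)
  open import Data.Bool using (T)
  open import Data.Fin using (Fin; zero; suc; _≟_)
  open import Data.Fin.Properties using (any?; all?; pigeonhole; suc-injective; <⇒≢)
  open import Data.Fin.Subset using (Subset; _∈_; _∉_; ∣_∣)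
  open import Data.Fin.Subset.Properties using (_∈?_; x∈⁅x⁆)
  open import Data.Nat as ℕ using (ℕ; zero; suc; _≤_; _≤?_; s≤s; z≤n)
  open import Data.Nat.Properties using (≤ᵇ⇒≤; ≤⇒≤ᵇ; ≰⇒>; <⇒≱; ≤-reflexive; ≤-trans; m≤n+m; n<1+n)
  open import Data.Product using (∃; _×_; _,_; proj₁; proj₂)
  open import Data.Sum using (inj₁; inj₂; [_,_]′)
  open import Function.Bundles using (Bijection; Equivalence)
  open import Relation.Binary using (Decidable)
  open import Relation.Binary.PropositionalEquality as ≡ using (_≡_; _≢_; subst; ≢-sym)
  open import Relation.Nullary using (¬_; Dec; yes; no; ¬?)
  open import Relation.Nullary.Decidable using (_×-dec_; decidable-stable)
  open import Relation.Nullary.Negation using (contradiction)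

  Represents : (F : Field) {r n : ℕ} → (Fin r → Fin n → Field.Carrier F) → Matroid n → Set
  Represents F A M =
    ∀ X → (T (indep M X) → ColumnsIndependent F A X) × (ColumnsIndependent F A X → T (indep M X))

  module UniformRank2 (F : Field) {r n : ℕ} (A : Fin r → Fin n → Field.Carrier F)
                      (A-represents : Represents F A (uniform 2 n)) where
    open FieldFacts F
    open CommutativeRing (Field.commRing F) hiding (zero)

    pair-columnsIndependent : ∀ {a b} → a ≢ b → ColumnsIndependent F A (pair a b)
    pair-columnsIndependent a≢b = proj₁ (A-represents (pair _ _)) (≤⇒≤ᵇ (≤-reflexive (∣pair∣≡2 a≢b)))

    triple-dependent : ∀ {a b k} → a ≢ b → a ≢ k → b ≢ k → ¬ ColumnsIndependent F A (triple a b k)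
    triple-dependent a≢b a≢k b≢k independent = <⇒≱ (s≤s (s≤s (s≤s z≤n)))
      (subst (_≤ 2) (∣triple∣≡3 a≢b a≢k b≢k) (≤ᵇ⇒≤ _ 2 (proj₂ (A-represents _) independent)))

    pair-independent : ∀ {a b} → a ≢ b → ∀ x y → (∀ i → x * A i a + y * A i b ≈ 0#) → y ≈ 0#
    pair-independent {a} {b} a≢b x y Ac≈0 = begin
      y          ≈⟨ +-identityˡ y ⟨
      0# + y     ≡⟨ ≡.cong₂ _+_ (δ-off a x b (λ b≡a → a≢b (≡.sym b≡a))) (δ-diag b y) ⟨
      c b        ≈⟨ pair-columnsIndependent a≢b c c-off (λ i → trans (·-δ₂ A a b x y i) (Ac≈0 i)) b b∈pair ⟩
      0#         ∎
      where
      c : Fin n → Carrier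
      c j = δ a x j + δ b y j
      b∈pair : b ∈ pair a b
      b∈pair = x∈p⇒x∈⁅y⁆∪p a (x∈⁅x⁆ b)
      c-off : ∀ j → j ∉ pair a b → c j ≈ 0#
      c-off j j∉ = trans (reflexive (≡.cong₂ _+_ (δ-off a x j (λ { ≡.refl → j∉ (x∈⁅x⁆∪p a) }))
                                                  (δ-off b y j (λ { ≡.refl → j∉ b∈pair }))))
                         (+-identityʳ 0#)

  module FiniteField
    (F : Field) {q : ℕ} (enumeration : Bijection (≡.setoid (Fin q)) (CommutativeRing.setoid (Field.commRing F)))
    where
    open FieldFacts F
    open Field F using (inverse)
    open CommutativeRing (Field.commRing F) hiding (zero)
    open Bijection enumeration using (injective; surjective) renaming (to to enum)

    enum-surjective : ∀ x → ∃ λ i → enum i ≈ x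
    enum-surjective x with surjective x
    ... | i , enum≈ = i , enum≈ ≡.refl

    index : Carrier → Fin q
    index x = proj₁ (enum-surjective x)

    enum-index : ∀ x → enum (index x) ≈ x
    enum-index x = proj₂ (enum-surjective x)

    infix 4 _≈?_
    _≈?_ : Decidable _≈_
    x ≈? y with index x ≟ index y
    ... | yes ix≡iy = yes (trans (sym (enum-index x)) (trans (reflexive (≡.cong enum ix≡iy)) (enum-index y)))
    ... | no  ix≢iy = no λ x≈y → ix≢iy (injective (trans (enum-index x) (trans x≈y (sym (enum-index y)))))

    isFinite : IsFinite F
    isFinite = q , enum , enum-surjective

    affineLine : Fin 2 → Fin q → Carrier
    affineLine zero       j = 1#
    affineLine (suc zero) j = enum j

    enum-difference≉0 : ∀ {j l} → j ≢ l → ¬ enum j - enum l ≈ 0#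
    enum-difference≉0 j≢l tj-tl≈0 = j≢l (injective (x∙y⁻¹≈ε⇒x≈y _ _ tj-tl≈0))

    module _ {X : Subset q} (∣X∣≤2 : ∣ X ∣ ≤ 2) (c : Fin q → Carrier) (c-off : ∀ j → j ∉ X → c j ≈ 0#)
             (Ac≈0 : ∀ i → (affineLine · c) i ≈ 0#) where

      only-member : ∀ {j} → (∀ l → l ∈ X → l ≡ j) → c j ≈ 0#
      only-member {j} only-j = begin
        c j                    ≈⟨ *-identityʳ (c j) ⟨
        c j * 1#               ≈⟨ ∑-vanishes-off₁ j off ⟨
        (affineLine · c) zero  ≈⟨ Ac≈0 zero ⟩
        0#                     ∎
        where
        off : ∀ l → l ≢ j → c l * 1# ≈ 0#
        off l l≢j with l ∈? X
        ... | yes l∈X = contradiction (only-j l l∈X) l≢j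
        ... | no  l∉X = trans (*-congʳ (c-off l l∉X)) (zeroˡ 1#)

      -- Σ c (t − t l) is row 1 minus t l times row 0, and only its j-th term survives.
      one-of-two-members : ∀ {j l} → j ∈ X → l ∈ X → j ≢ l → c j ≈ 0#
      one-of-two-members {j} {l} j∈X l∈X j≢l = x*y≈0⇒x≈0 cj[tj-tl]≈0 (enum-difference≉0 j≢l)
        where
        t : Fin q → Carrier
        t = enum
        f : Fin q → Carrier
        f j' = c j' * (t j' - t l)
        split : ∀ j' → f j' ≈ c j' * t j' + - t l * (c j' * 1#)
        split j' = begin
          c j' * (t j' - t l)                ≈⟨ distribˡ (c j') (t j') (- t l) ⟩
          c j' * t j' + c j' * - t l         ≈⟨ +-congˡ (-‿distribʳ-* (c j') (t l)) ⟨
          c j' * t j' + - (c j' * t l)       ≈⟨ +-congˡ (-‿cong (*-comm (c j') (t l))) ⟩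
          c j' * t j' + - (t l * c j')       ≈⟨ +-congˡ (-‿distribˡ-* (t l) (c j')) ⟩
          c j' * t j' + - t l * c j'         ≈⟨ +-congˡ (*-congˡ (*-identityʳ (c j'))) ⟨
          c j' * t j' + - t l * (c j' * 1#)  ∎
        ∑f≈0 : ∑ f ≈ 0#
        ∑f≈0 = begin
          ∑ f                                                           ≈⟨ ∑-cong split ⟩
          ∑ (λ j' → c j' * t j' + - t l * (c j' * 1#))
            ≈⟨ ∑-+ (λ j' → c j' * t j') (λ j' → - t l * (c j' * 1#)) ⟩
          (affineLine · c) (suc zero) + ∑ (λ j' → - t l * (c j' * 1#))
            ≈⟨ +-congˡ (∑-*ˡ (- t l) (λ j' → c j' * 1#)) ⟨
          (affineLine · c) (suc zero) + - t l * (affineLine · c) zero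
            ≈⟨ +-cong (Ac≈0 (suc zero)) (trans (*-congˡ (Ac≈0 zero)) (zeroʳ (- t l))) ⟩
          0# + 0#                                                       ≈⟨ +-identityʳ 0# ⟩
          0#                                                            ∎
        off : ∀ j' → j' ≢ j → f j' ≈ 0#
        off j' j'≢j with j' ∈? X | j' ≟ l
        ... | no  j'∉X | _          = trans (*-congʳ (c-off j' j'∉X)) (zeroˡ _)
        ... | yes _    | yes ≡.refl = trans (*-congˡ (-‿inverseʳ (t l))) (zeroʳ (c l))
        ... | yes j'∈X | no  j'≢l   =
          contradiction (distinct₃⇒3≤∣p∣ j∈X l∈X j'∈X j≢l (≢-sym j'≢j) (≢-sym j'≢l)) (<⇒≱ (s≤s ∣X∣≤2))
        cj[tj-tl]≈0 : c j * (t j - t l) ≈ 0#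
        cj[tj-tl]≈0 = trans (sym (∑-vanishes-off₁ j off)) ∑f≈0

    affineLine-independent : ∀ X → ∣ X ∣ ≤ 2 → ColumnsIndependent F affineLine X
    affineLine-independent X ∣X∣≤2 c c-off Ac≈0 j j∈X with any? (λ l → (l ∈? X) ×-dec ¬? (l ≟ j))
    ... | yes (l , l∈X , l≢j) = one-of-two-members ∣X∣≤2 c c-off Ac≈0 j∈X l∈X (≢-sym l≢j)
    ... | no  ∄l              =
      only-member ∣X∣≤2 c c-off Ac≈0 λ l l∈X → decidable-stable (l ≟ j) (λ l≢j → ∄l (l , l∈X , l≢j))

    independent⇒∣X∣≤2 : ∀ X → ColumnsIndependent F affineLine X → ∣ X ∣ ≤ 2
    independent⇒∣X∣≤2 X independent with ∣ X ∣ ≤? 2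
    ... | yes ∣X∣≤2 = ∣X∣≤2
    ... | no  ∣X∣≰2 with 3≤∣p∣⇒distinct₃ (≰⇒> ∣X∣≰2)
    ...   | a , b , k , a∈X , b∈X , k∈X , a≢b , a≢k , b≢k =
      contradiction (trans (sym ca≈tb-tk) (independent c c-off Ac≈0 a a∈X)) (enum-difference≉0 b≢k)
      where
      t : Fin q → Carrier
      t = enum
      c : Fin q → Carrier
      c j = δ a (t b - t k) j + δ b (t k - t a) j + δ k (t a - t b) j
      c-off : ∀ j → j ∉ X → c j ≈ 0#
      c-off j j∉X = begin
        c j
          ≡⟨ ≡.cong₂ (λ u v → u + v + δ k (t a - t b) j) (δ-off a _ j (λ { ≡.refl → j∉X a∈X }))
                                                          (δ-off b _ j (λ { ≡.refl → j∉X b∈X })) ⟩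
        0# + 0# + δ k (t a - t b) j  ≡⟨ ≡.cong (0# + 0# +_) (δ-off k _ j (λ { ≡.refl → j∉X k∈X })) ⟩
        0# + 0# + 0#                 ≈⟨ trans (+-identityʳ _) (+-identityʳ 0#) ⟩
        0#                           ∎
      ca≈tb-tk : c a ≈ t b - t k
      ca≈tb-tk = begin
        c a
          ≡⟨ ≡.cong₂ (λ u v → u + v + δ k (t a - t b) a) (δ-diag a _) (δ-off b _ a a≢b) ⟩
        t b - t k + 0# + δ k (t a - t b) a  ≡⟨ ≡.cong (t b - t k + 0# +_) (δ-off k _ a a≢k) ⟩
        t b - t k + 0# + 0#                 ≈⟨ trans (+-identityʳ _) (+-identityʳ _) ⟩
        t b - t k                           ∎
      Ac≈0 : ∀ i → (affineLine · c) i ≈ 0#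
      Ac≈0 i = trans (·-δ₃ affineLine a b k _ _ _ i) (row i)
        where
        row : ∀ i → (t b - t k) * affineLine i a + (t k - t a) * affineLine i b + (t a - t b) * affineLine i k
                    ≈ 0#
        row zero       = trans (+-cong (+-cong (*-identityʳ _) (*-identityʳ _)) (*-identityʳ _))
                               (cyclic-difference (t b) (t k) (t a))
        row (suc zero) = cyclic-product (t a) (t b) (t k)

    uniform₂-representable : Representable F (uniform 2 q)
    uniform₂-representable = 2 , affineLine , λ X →
      (λ X-indep → affineLine-independent X (≤ᵇ⇒≤ _ 2 X-indep)) ,
      (λ independent → ≤⇒≤ᵇ (independent⇒∣X∣≤2 X independent))

    module _ {r n : ℕ} (A : Fin r → Fin n → Carrier) (A-represents : Represents F A (uniform 2 n)) where
      open UniformRank2 F A A-represents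

      -- Without a k-th term a relation on the triple is one on the independent pair; with one, it puts
      -- column k in the span of columns a and b.
      outside-span⇒triple-independent : ∀ {a b k} → a ≢ b → a ≢ k → b ≢ k →
                                        ¬ (∃ λ s → ∃ λ u → ∀ i → A i k ≈ s * A i a + u * A i b) →
                                        ColumnsIndependent F A (triple a b k)
      outside-span⇒triple-independent {a} {b} {k} a≢b a≢k b≢k outside-span c c-off Ac≈0 = by-cases (c k ≈? 0#)
        where
        off : ∀ j → j ≢ a → j ≢ b → j ≢ k → c j ≈ 0#
        off j j≢a j≢b j≢k = c-off j λ j∈ → [ j≢a , [ j≢b , j≢k ]′ ]′ (x∈triple⁻ j∈)
        relation : ∀ i → c a * A i a + c b * A i b + c k * A i k ≈ 0#
        relation i = trans (sym (∑-vanishes-off₃ a≢b a≢k b≢k λ j j≢a j≢b j≢k →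
                                  trans (*-congʳ (off j j≢a j≢b j≢k)) (zeroˡ (A i j))))
                           (Ac≈0 i)
        on-pair : c k ≈ 0# → ∀ j → j ∈ pair a b → c j ≈ 0#
        on-pair ck≈0 = pair-columnsIndependent a≢b c pair-off Ac≈0
          where
          pair-off : ∀ l → l ∉ pair a b → c l ≈ 0#
          pair-off l l∉ with l ≟ k
          ... | yes ≡.refl = ck≈0
          ... | no  l≢k    =
            off l (λ { ≡.refl → l∉ (x∈⁅x⁆∪p a) }) (λ { ≡.refl → l∉ (x∈p⇒x∈⁅y⁆∪p a (x∈⁅x⁆ b)) }) l≢k
        by-cases : Dec (c k ≈ 0#) → ∀ j → j ∈ triple a b k → c j ≈ 0#
        by-cases (yes ck≈0) j j∈ with x∈triple⁻ j∈
        ... | inj₁ ≡.refl        = on-pair ck≈0 a (x∈⁅x⁆∪p a)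
        ... | inj₂ (inj₁ ≡.refl) = on-pair ck≈0 b (x∈p⇒x∈⁅y⁆∪p a (x∈⁅x⁆ b))
        ... | inj₂ (inj₂ ≡.refl) = ck≈0
        by-cases (no ck≉0) = contradiction (- (d * c a) , - (d * c b) , in-span) outside-span
          where
          d : Carrier
          d = proj₁ (inverse (c k) ck≉0)
          in-span : ∀ i → A i k ≈ - (d * c a) * A i a + - (d * c b) * A i b
          in-span i = trans (solve-linear (proj₂ (inverse (c k) ck≉0)) (relation i))
                            (-‿scale-combination d (c a) (c b) (A i a) (A i b))

      column-in-span : ∀ {a b k} → a ≢ b → a ≢ k → b ≢ k → ∃ λ s → ∃ λ u → ∀ i → A i k ≈ s * A i a + u * A i b
      column-in-span {a} {b} {k} a≢b a≢k b≢k
        with any? (λ s → any? (λ u → all? (λ i → A i k ≈? enum s * A i a + enum u * A i b)))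
      ... | yes (s , u , in-span) = enum s , enum u , in-span
      ... | no  not-in-span       =
        contradiction (outside-span⇒triple-independent a≢b a≢k b≢k outside-span) (triple-dependent a≢b a≢k b≢k)
        where
        outside-span : ¬ (∃ λ s → ∃ λ u → ∀ i → A i k ≈ s * A i a + u * A i b)
        outside-span (s , u , in-span) = not-in-span (index s , index u , λ i →
          trans (in-span i) (+-cong (*-congʳ (sym (enum-index s))) (*-congʳ (sym (enum-index u)))))

    module _ {r : ℕ} (A : Fin r → Fin (3 ℕ.+ q) → Carrier)
             (A-represents : Represents F A (uniform 2 (3 ℕ.+ q))) where
      open UniformRank2 F A A-represents

      column : Fin (suc q) → Fin (3 ℕ.+ q)
      column t = suc (suc t)

      coefficients : ∀ t → ∃ λ s → ∃ λ u → ∀ i → A i (column t) ≈ s * A i zero + u * A i (suc zero)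
      coefficients t = column-in-span A A-represents (λ ()) (λ ()) (λ ())

      s u : Fin (suc q) → Carrier
      s t = proj₁ (coefficients t)
      u t = proj₁ (proj₂ (coefficients t))

      in-span : ∀ t i → A i (column t) ≈ s t * A i zero + u t * A i (suc zero)
      in-span t = proj₂ (proj₂ (coefficients t))

      u≉0 : ∀ t → ¬ u t ≈ 0#
      u≉0 t ut≈0 = -x≉0 1≉0 (pair-independent (λ ()) (s t) (- 1#) dependence)
        where
        dependence : ∀ i → s t * A i zero + - 1# * A i (column t) ≈ 0#
        dependence i = begin
          s t * A i zero + - 1# * A i (column t)   ≈⟨ +-congˡ (-1*x≈-x _) ⟩
          s t * A i zero + - A i (column t)        ≈⟨ +-congˡ (-‿cong (in-span t i)) ⟩
          s t * A i zero + - (s t * A i zero + u t * A i (suc zero))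
            ≈⟨ +-congˡ (-‿cong (trans (+-congˡ (trans (*-congʳ ut≈0) (zeroˡ _))) (+-identityʳ _))) ⟩
          s t * A i zero + - (s t * A i zero)      ≈⟨ -‿inverseʳ _ ⟩
          0#                                       ∎

      u⁻¹ : Fin (suc q) → Carrier
      u⁻¹ t = proj₁ (inverse (u t) (u≉0 t))

      slope : Fin (suc q) → Fin q
      slope t = index (s t * u⁻¹ t)

      -- Columns of equal slope are proportional, hence dependent.
      slope-injective : ∀ {t t'} → t ≢ t' → slope t ≢ slope t'
      slope-injective {t} {t'} t≢t' slope≡ =
        -x≉0 (u≉0 t) (pair-independent column≢ (u t') (- u t) λ i →
          proportional-combinations (in-span t i) (in-span t' i)
            (cross-multiply (proj₂ (inverse (u t) (u≉0 t))) (proj₂ (inverse (u t') (u≉0 t'))) slopes≈))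
        where
        column≢ : column t ≢ column t'
        column≢ eq = t≢t' (suc-injective (suc-injective eq))
        slopes≈ : s t * u⁻¹ t ≈ s t' * u⁻¹ t'
        slopes≈ = trans (sym (enum-index _)) (trans (reflexive (≡.cong enum slope≡)) (enum-index _))

    uniform₂-nonrepresentable : ¬ Representable F (uniform 2 (3 ℕ.+ q))
    uniform₂-nonrepresentable (r , A , A-represents) =
      let t , t' , t<t' , slope≡ = pigeonhole (n<1+n q) (slope A A-represents)
      in  slope-injective A A-represents (<⇒≢ t<t') slope≡

    representability-not-definable : ∀ {N ψ} → threshold 2 N ≤ q → IsSentence ψ → numVars ψ ≤ N →
                                     ¬ (∀ n (M : Matroid n) → Representable F M ⇔ Satisfies M ψ)
    representability-not-definable {N} {ψ} T≤q ψ-sentence numVars≤N defines =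
      uniform₂-nonrepresentable (Equivalence.from (defines (3 ℕ.+ q) (uniform 2 (3 ℕ.+ q))) satisfies-U₂,₃₊q)
      where
      satisfies-U₂,q : Satisfies (uniform 2 q) ψ
      satisfies-U₂,q = Equivalence.to (defines q (uniform 2 q)) uniform₂-representable
      satisfies-U₂,₃₊q : Satisfies (uniform 2 (3 ℕ.+ q)) ψ
      satisfies-U₂,₃₊q =
        Satisfies-transfer (uniform-isUniform 2 q) (uniform-isUniform 2 (3 ℕ.+ q)) ψ-sentence
          (≤-trans (depth≤numVars (proj₁ ψ-sentence)) numVars≤N) T≤q (≤-trans T≤q (m≤n+m q 3)) satisfies-U₂,q

module PrimeFields where
  open import Level using (0ℓ)
  open import Algebra.Bundles using (CommutativeRing)
  open import Algebra.Structures using (IsCommutativeRing)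
  open import Data.Fin using (Fin; toℕ; fromℕ<)
  open import Data.Fin.Properties using (toℕ-injective; toℕ-fromℕ<; toℕ<n)
  open import Data.List using ([]; _∷_)
  open import Data.List.Relation.Unary.All using (_∷_)
  open import Data.Nat
    using (ℕ; suc; pred; _+_; _*_; _<_; _≤_; _%_; _!; _<?_; NonZero; ≢-nonZero; ≢-nonZero⁻¹; nonTrivial⇒n>1; nonTrivial⇒≢1)
  open import Data.Nat.Coprimality using (prime⇒coprime; coprime-Bézout)
  open import Data.Nat.Divisibility using (_∣_; m∣m*n; ∣-trans; m≤n⇒m!∣n!; ∣m+n∣m⇒∣n; ∣1⇒≡1)
  open import Data.Nat.DivMod using (%-distribˡ-+; %-distribˡ-*; m*n%n≡0; m%n<n; m%n%n≡m%n; m<n⇒m%n≡m)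
  open import Data.Nat.GCD using (module Bézout)
  open import Data.Nat.ListAction using (product)
  open import Data.Nat.Primality using (Prime; prime⇒nonZero; prime⇒nonTrivial)
  open import Data.Nat.Primality.Factorisation using (factorise)
  open import Data.Nat.Properties
  open import Data.Product using (∃; _×_; _,_)
  open import Function.Bundles using (Bijection)
  open import Relation.Binary.PropositionalEquality as ≡
    using (_≡_; refl; sym; trans; cong; cong₂; subst; module ≡-Reasoning)
  open import Relation.Nullary using (¬_; yes; no)
  open import Relation.Nullary.Negation using (contradiction)

  module Modular (p : ℕ) .{{_ : NonZero p}} where

    infix 4 _≡ₘ_

    record _≡ₘ_ (x y : ℕ) : Set where
      constructor mod
      field %-≡ : x % p ≡ y % p

    ≡⇒≡ₘ : ∀ {x y} → x ≡ y → x ≡ₘ y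
    ≡⇒≡ₘ x≡y = mod (cong (_% p) x≡y)

    +-cong : ∀ {x x' y y'} → x ≡ₘ x' → y ≡ₘ y' → x + y ≡ₘ x' + y'
    +-cong {x} {x'} {y} {y'} (mod e) (mod f) = mod (begin
      (x + y) % p               ≡⟨ %-distribˡ-+ x y p ⟩
      (x % p + y % p) % p       ≡⟨ cong₂ (λ a b → (a + b) % p) e f ⟩
      (x' % p + y' % p) % p     ≡⟨ %-distribˡ-+ x' y' p ⟨
      (x' + y') % p             ∎)
      where open ≡-Reasoning

    *-cong : ∀ {x x' y y'} → x ≡ₘ x' → y ≡ₘ y' → x * y ≡ₘ x' * y'
    *-cong {x} {x'} {y} {y'} (mod e) (mod f) = mod (begin
      (x * y) % p               ≡⟨ %-distribˡ-* x y p ⟩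
      (x % p * (y % p)) % p     ≡⟨ cong₂ (λ a b → (a * b) % p) e f ⟩
      (x' % p * (y' % p)) % p   ≡⟨ %-distribˡ-* x' y' p ⟨
      (x' * y') % p             ∎)
      where open ≡-Reasoning

    -ₘ_ : ℕ → ℕ
    -ₘ x = pred p * x

    -ₘx+x≡ₘ0 : ∀ x → -ₘ x + x ≡ₘ 0
    -ₘx+x≡ₘ0 x = mod (begin
      (pred p * x + x) % p ≡⟨ cong (_% p) (+-comm (pred p * x) x) ⟩
      (suc (pred p) * x) % p ≡⟨ cong (λ n → (n * x) % p) (suc-pred p) ⟩
      (p * x) % p ≡⟨ cong (_% p) (*-comm p x) ⟩
      (x * p) % p ≡⟨ m*n%n≡0 x p ⟩
      0           ≡⟨ m*n%n≡0 0 p ⟨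
      0 % p       ∎)
      where open ≡-Reasoning

    isCommutativeRing : IsCommutativeRing _≡ₘ_ _+_ _*_ -ₘ_ 0 1
    isCommutativeRing = record
      { isRing = record
        { +-isAbelianGroup = record
          { isGroup = record
            { isMonoid = record
              { isSemigroup = record
                { isMagma = record
                  { isEquivalence = record
                    { refl  = mod refl
                    ; sym   = λ (mod e) → mod (sym e)
                    ; trans = λ (mod e) (mod f) → mod (trans e f) }
                  ; ∙-cong = +-cong }
                ; assoc = λ x y z → ≡⇒≡ₘ (+-assoc x y z) }
              ; identity = (λ x → mod refl) , (λ x → ≡⇒≡ₘ (+-identityʳ x)) }
            ; inverse = -ₘx+x≡ₘ0 , (λ x → ≡ₘ-trans (≡⇒≡ₘ (+-comm x (-ₘ x))) (-ₘx+x≡ₘ0 x))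
            ; ⁻¹-cong = *-cong {pred p} (mod refl) }
          ; comm = λ x y → ≡⇒≡ₘ (+-comm x y) }
        ; *-cong = *-cong
        ; *-assoc = λ x y z → ≡⇒≡ₘ (*-assoc x y z)
        ; *-identity = (λ x → ≡⇒≡ₘ (*-identityˡ x)) , (λ x → ≡⇒≡ₘ (*-identityʳ x))
        ; distrib = (λ x y z → ≡⇒≡ₘ (*-distribˡ-+ x y z)) , (λ x y z → ≡⇒≡ₘ (*-distribʳ-+ x y z)) }
      ; *-comm = λ x y → ≡⇒≡ₘ (*-comm x y) }
      where
      ≡ₘ-trans : ∀ {x y z} → x ≡ₘ y → y ≡ₘ z → x ≡ₘ z
      ≡ₘ-trans (mod e) (mod f) = mod (trans e f)

    commutativeRing : CommutativeRing 0ℓ 0ℓ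
    commutativeRing = record { isCommutativeRing = isCommutativeRing }

  module _ (p : ℕ) (p-prime : Prime p) where
    private instance
      p≢0 : NonZero p
      p≢0 = prime⇒nonZero p-prime

    open Modular p
    open CommutativeRing commutativeRing
      using (ring; +-group; setoid) renaming (refl to ≡ₘ-refl; trans to ≡ₘ-trans)
    open import Algebra.Properties.Ring ring using (-‿distribʳ-*)
    open import Algebra.Properties.Group +-group using (inverseʳ-unique; ⁻¹-involutive)

    multiple≡ₘ0 : ∀ a → a * p ≡ₘ 0
    multiple≡ₘ0 a = mod (trans (m*n%n≡0 a p) (sym (m*n%n≡0 0 p)))

    inverseₘ : ∀ x → ¬ x ≡ₘ 0 → ∃ λ y → x * y ≡ₘ 1
    inverseₘ x x≢0 = invert (coprime-Bézout (prime⇒coprime p-prime {{r≢0}} (m%n<n x p)))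
      where
      r = x % p
      r≢0 : NonZero r
      r≢0 = ≢-nonZero (λ r≡0 → x≢0 (mod (trans r≡0 (sym (m*n%n≡0 0 p)))))
      x≡ₘr : x ≡ₘ r
      x≡ₘr = mod (sym (m%n%n≡m%n x p))
      open import Relation.Binary.Reasoning.Setoid setoid
      invert : Bézout.Identity 1 p r → ∃ λ y → x * y ≡ₘ 1
      invert (Bézout.+- a b 1+br≡ap) = -ₘ b , (begin
        x * (-ₘ b)     ≈⟨ -‿distribʳ-* x b ⟨
        -ₘ (x * b)     ≈⟨ *-cong {pred p} ≡ₘ-refl (*-cong x≡ₘr ≡ₘ-refl) ⟩
        -ₘ (r * b)     ≈⟨ *-cong {pred p} ≡ₘ-refl (≡⇒≡ₘ (*-comm r b)) ⟩
        -ₘ (b * r)     ≈⟨ *-cong {pred p} ≡ₘ-refl (inverseʳ-unique 1 (b * r) 1+br≡ₘ0) ⟩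
        -ₘ (-ₘ 1)      ≈⟨ ⁻¹-involutive 1 ⟩
        1              ∎)
        where
        1+br≡ₘ0 : 1 + b * r ≡ₘ 0
        1+br≡ₘ0 = ≡ₘ-trans (≡⇒≡ₘ 1+br≡ap) (multiple≡ₘ0 a)
      invert (Bézout.-+ a b 1+ap≡br) = b , (begin
        x * b          ≈⟨ *-cong x≡ₘr ≡ₘ-refl ⟩
        r * b          ≈⟨ ≡⇒≡ₘ (trans (*-comm r b) (sym 1+ap≡br)) ⟩
        1 + a * p      ≈⟨ +-cong {1} ≡ₘ-refl (multiple≡ₘ0 a) ⟩
        1              ∎)

    0≢ₘ1 : ¬ 0 ≡ₘ 1
    0≢ₘ1 (mod 0%p≡1%p) = 0≢1+n (trans (sym (m*n%n≡0 0 p))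
      (trans 0%p≡1%p (m<n⇒m%n≡m (nonTrivial⇒n>1 p {{prime⇒nonTrivial p-prime}}))))

    GF : Field
    GF = record { commRing = commutativeRing ; 0≉1 = 0≢ₘ1 ; inverse = inverseₘ }

    GF-enumeration : Bijection (≡.setoid (Fin p)) setoid
    GF-enumeration = record
      { to        = toℕ
      ; cong      = λ i≡j → ≡⇒≡ₘ (cong toℕ i≡j)
      ; bijective = injective , surjective }
      where
      toℕ%p : ∀ i → toℕ i % p ≡ toℕ i
      toℕ%p i = m<n⇒m%n≡m (toℕ<n i)
      injective : ∀ {i j} → toℕ i ≡ₘ toℕ j → i ≡ j
      injective {i} {j} (mod e) = toℕ-injective (trans (sym (toℕ%p i)) (trans e (toℕ%p j)))
      surjective : ∀ y → ∃ λ i → ∀ {j} → j ≡ i → toℕ j ≡ₘ y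
      surjective y =
        fromℕ< (m%n<n y p) , λ { refl → mod (trans (cong (_% p) (toℕ-fromℕ< _)) (m%n%n≡m%n y p)) }

  n∣n! : ∀ n .{{_ : NonZero n}} → n ∣ n !
  n∣n! (suc n) = m∣m*n (n !)

  prime∣n!+1⇒n<p : ∀ {p n} → Prime p → p ∣ suc (n !) → n < p
  prime∣n!+1⇒n<p {p} {n} p-prime p∣n!+1 with n <? p
  ... | yes n<p = n<p
  ... | no  n≮p = contradiction (∣1⇒≡1 (∣m+n∣m⇒∣n (subst (p ∣_) (+-comm 1 (n !)) p∣n!+1) p∣n!))
                                (nonTrivial⇒≢1 {{prime⇒nonTrivial p-prime}})
    where
    p∣n! : p ∣ n !
    p∣n! = ∣-trans (n∣n! p {{prime⇒nonZero p-prime}}) (m≤n⇒m!∣n! (≮⇒≥ n≮p))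

  ∃-prime≥ : ∀ n → ∃ λ p → Prime p × n ≤ p
  ∃-prime≥ n with factorise (suc (n !))
  ... | record { factors = [] ; isFactorisation = n!+1≡1 } =
    contradiction (suc-injective n!+1≡1) (≢-nonZero⁻¹ (n !) {{n !≢0}})
  ... | record { factors = p ∷ ps ; isFactorisation = n!+1≡p*Πps ; factorsPrime = p-prime ∷ _ } =
    p , p-prime , <⇒≤ (prime∣n!+1⇒n<p p-prime (subst (p ∣_) (sym n!+1≡p*Πps) (m∣m*n (product ps))))

open import Data.Product using (_,_)
open Transfer using (threshold)
open PrimeFields using (GF; GF-enumeration; ∃-prime≥)
open Representations using (module FiniteField)

corollary1p5 : ¬ (Σ ℕ λ N → (F : Field) → IsFinite F →
                    Σ Formula λ ψ → IsSentence ψ × numVars ψ ≤ N ×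
                      (∀ (n : ℕ) (M : Matroid n) → Representable F M ⇔ Satisfies M ψ))
corollary1p5 (N , defining-sentence) =
  let p , p-prime , threshold≤p = ∃-prime≥ (threshold 2 N)
      open FiniteField (GF p p-prime) (GF-enumeration p p-prime)
      ψ , ψ-sentence , numVars≤N , defines = defining-sentence (GF p p-prime) isFinite
  in  representability-not-definable threshold≤p ψ-sentence numVars≤N defines
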